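{- Let $n,f$ be positive integers and $\alpha$ an integer with $0<\alpha<n/2$. Let $C$ be a binary $(n,2fn)$ code such that $\{i\in\{0,1,\ldots,n\}:A_i(C)\ne0\}=\{0,n/2\pm\alpha,n/2,n\}$ and $C=C_1\cup\cdots\cup C_f$ where each $C_i$ has distance distribution with $A_0(C_i)=1$, $A_{n/2}(C_i)=2n-2$, $A_n(C_i)=1$ and all other $A_j(C_i)=0$. Then, with $l=(n/(2\alpha))^2$, \[ (A_0(C),A_{n/2-\alpha}(C),A_{n/2}(C),A_{n/2+\alpha}(C),A_n(C))=(1,(f-1)l,\ 2n-2+(f-1)(2n-2l),\ (f-1)l,\ 1), \] and all other $A_j(C)$ are $0$.
   Context: A binary $(n,M)$ code is a subset of $\mathbb{Z}_2^n$ of size $M$; $d$ is Hamming distance and $A_i(C)=\frac{1}{|C|}|\{(x,x')\in C\times C: d(x,x')=i\}|$. -}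

module Defs where

open import Data.Bool using (Bool; true; false; if_then_else_; _xor_)
open import Data.Nat as ℕ using (ℕ; zero; suc)
open import Data.Integer using (+_)
open import Data.Rational using (ℚ; _/_; 0ℚ; _*_)
open import Data.Vec using (Vec; []; _∷_)
open import Data.List using (List; []; _∷_; length; map)
open import Data.Nat.ListAction using (sum)

Word : ℕ → Set
Word n = Vec Bool n

hamming : ∀ {n} → Word n → Word n → ℕ
hamming []       []       = 0
hamming (x ∷ xs) (y ∷ ys) with x xor y
... | true  = suc (hamming xs ys)
... | false = hamming xs ys

pairCount : ∀ {n} → List (Word n) → ℕ → ℕ
pairCount C i = sum (map (λ x → sum (map (λ y → if hamming x y ℕ.≡ᵇ i then 1 else 0) C)) C)

-- A_i(C) = (1/|C|) |{(x,x') ∈ C × C : d(x,x') = i}|  (set to 0 for the empty code)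
A : ∀ {n} → List (Word n) → ℕ → ℚ
A []       i = 0ℚ
A (c ∷ cs) i = + pairCount (c ∷ cs) i / suc (length cs)

ℕ→ℚ : ℕ → ℚ
ℕ→ℚ k = + k / 1

-- l = (n / (2α))^2   (α = 0 is excluded by hypothesis; value 0 there is irrelevant)
ell : ℕ → ℕ → ℚ
ell n zero      = 0ℚ
ell n (suc a)   = (+ n / (2 ℕ.* suc a)) * (+ n / (2 ℕ.* suc a))

module Submission where

-- Send a word x to the ±1 vector (-1)^x, so that n - 2 d(x,y) is the inner product ⟨x,y⟩.
-- For a list Φ of functions on words, ∑_{x,y∈X} ∑_{φ∈Φ} φ(x)φ(y) = ∑_{φ∈Φ} (∑_{x∈X} φ(x))², so it
-- vanishes exactly when every φ sums to zero over X. With the coordinates, the off-diagonal products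
-- of two coordinates and the products of three coordinates as Φ, the inner sums are ⟨x,y⟩, ⟨x,y⟩² - n
-- and ⟨x,y⟩³, so these three moments of the distance distribution vanish for each Cᵢ. Hence every φ
-- sums to zero over each Cᵢ and so over C, which counting shows to be their disjoint union.
-- Together with ∑ᵢ Aᵢ(C) = |C| this gives four equations for the five unknown counts: the first and
-- third moments force A_n(C) = A_0(C) and A_{n/2-α}(C) = A_{n/2+α}(C), the other two determine the rest.
-- For odd n the parts only have distances 0 and n, so |Cᵢ| = 2, which is incompatible with |C| = 2fn.

module FiniteSums where

  open import Data.Nat as ℕ using (ℕ; suc)
  import Data.Nat.Properties as ℕ
  open import Data.Integer using (ℤ; +_; -[1+_]; 0ℤ; _+_; _*_; ∣_∣)
  import Data.Integer.Properties as ℤ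
  open import Data.Fin using (Fin) renaming (zero to fzero; suc to fsuc)
  open import Data.List using (List; []; _∷_; _++_; map; concat; concatMap; length; tabulate; allFin)
  import Data.List.Properties as List
  open import Data.List.Membership.Propositional using (_∈_)
  open import Data.List.Relation.Unary.Any using (here; there)
  open import Data.List.Relation.Binary.Permutation.Propositional as ↭ using (_↭_)
  open import Data.Sum using (inj₁; inj₂)
  open import Relation.Binary.PropositionalEquality using (_≡_; refl; cong; cong₂; sym; trans; module ≡-Reasoning)
  open import Data.Integer.Tactic.RingSolver using (solve-∀)
  open ≡-Reasoning

  ∑ : ∀ {A : Set} → List A → (A → ℤ) → ℤ
  ∑ []       f = 0ℤ
  ∑ (x ∷ xs) f = f x + ∑ xs f

  syntax ∑ xs (λ x → e) = ∑[ x ∈ xs ] e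

  module _ {A : Set} where

    ∑-cong : (xs : List A) {f g : A → ℤ} → (∀ x → x ∈ xs → f x ≡ g x) → ∑ xs f ≡ ∑ xs g
    ∑-cong []       f≗g = refl
    ∑-cong (x ∷ xs) f≗g = cong₂ _+_ (f≗g x (here refl)) (∑-cong xs (λ y y∈ → f≗g y (there y∈)))

    ∑-+ : (xs : List A) (f g : A → ℤ) → ∑[ x ∈ xs ] (f x + g x) ≡ ∑ xs f + ∑ xs g
    ∑-+ []       f g = refl
    ∑-+ (x ∷ xs) f g = trans (cong (_+_ (f x + g x)) (∑-+ xs f g)) (swap-middle (f x) (g x) (∑ xs f) (∑ xs g))
      where swap-middle : ∀ a b c d → a + b + (c + d) ≡ a + c + (b + d)
            swap-middle = solve-∀

    ∑-*ˡ : (xs : List A) (c : ℤ) (f : A → ℤ) → ∑[ x ∈ xs ] (c * f x) ≡ c * ∑ xs f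
    ∑-*ˡ []       c f = sym (ℤ.*-zeroʳ c)
    ∑-*ˡ (x ∷ xs) c f = trans (cong (_+_ (c * f x)) (∑-*ˡ xs c f)) (sym (ℤ.*-distribˡ-+ c (f x) (∑ xs f)))

    ∑-*ʳ : (xs : List A) (c : ℤ) (f : A → ℤ) → ∑[ x ∈ xs ] (f x * c) ≡ ∑ xs f * c
    ∑-*ʳ xs c f = begin
      ∑[ x ∈ xs ] (f x * c) ≡⟨ ∑-cong xs (λ x _ → ℤ.*-comm (f x) c) ⟩
      ∑[ x ∈ xs ] (c * f x) ≡⟨ ∑-*ˡ xs c f ⟩
      c * ∑ xs f            ≡⟨ ℤ.*-comm c _ ⟩
      ∑ xs f * c            ∎

    ∑-zero : (xs : List A) (f : A → ℤ) → (∀ x → x ∈ xs → f x ≡ 0ℤ) → ∑ xs f ≡ 0ℤ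
    ∑-zero []       f f≡0 = refl
    ∑-zero (x ∷ xs) f f≡0 = cong₂ _+_ (f≡0 x (here refl)) (∑-zero xs f (λ y y∈ → f≡0 y (there y∈)))

    ∑-const : (xs : List A) (c : ℤ) → ∑[ _ ∈ xs ] c ≡ + length xs * c
    ∑-const []       c = sym (ℤ.*-zeroˡ c)
    ∑-const (x ∷ xs) c = begin
      c + ∑[ _ ∈ xs ] c       ≡⟨ cong (_+_ c) (∑-const xs c) ⟩
      c + + length xs * c     ≡⟨ sym (ℤ.suc-* (+ length xs) c) ⟩
      + suc (length xs) * c   ∎

    ∑-++ : (xs ys : List A) (f : A → ℤ) → ∑ (xs ++ ys) f ≡ ∑ xs f + ∑ ys f
    ∑-++ []       ys f = sym (ℤ.+-identityˡ _)
    ∑-++ (x ∷ xs) ys f = trans (cong (_+_ (f x)) (∑-++ xs ys f)) (sym (ℤ.+-assoc (f x) _ _))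

    ∑-↭ : {xs ys : List A} (f : A → ℤ) → xs ↭ ys → ∑ xs f ≡ ∑ ys f
    ∑-↭ f ↭.refl         = refl
    ∑-↭ f (↭.prep x p)   = cong (_+_ (f x)) (∑-↭ f p)
    ∑-↭ f (↭.swap x y p) = trans (cong (λ s → f x + (f y + s)) (∑-↭ f p)) (exchange (f x) (f y) _)
      where exchange : ∀ a b c → a + (b + c) ≡ b + (a + c)
            exchange = solve-∀
    ∑-↭ f (↭.trans p q)  = trans (∑-↭ f p) (∑-↭ f q)

    ∑-concat : (xss : List (List A)) (f : A → ℤ) → ∑ (concat xss) f ≡ ∑[ xs ∈ xss ] ∑ xs f
    ∑-concat []         f = refl
    ∑-concat (xs ∷ xss) f = trans (∑-++ xs (concat xss) f) (cong (_+_ (∑ xs f)) (∑-concat xss f))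

    ∑-square≡0 : (xs : List A) (f : A → ℤ) → ∑[ x ∈ xs ] (f x * f x) ≡ 0ℤ → ∀ x → x ∈ xs → f x ≡ 0ℤ
    ∑-square≡0 xs f sum≡0 = squares≡0 xs (ℤ.+-injective (trans (sym (∑-squares xs)) sum≡0))
      where
      square≡∣∣² : ∀ i → i * i ≡ + (∣ i ∣ ℕ.* ∣ i ∣)
      square≡∣∣² (+ a)    = sym (ℤ.pos-* a a)
      square≡∣∣² -[1+ a ] = refl

      natSquares : List A → ℕ
      natSquares []       = 0
      natSquares (x ∷ xs) = ∣ f x ∣ ℕ.* ∣ f x ∣ ℕ.+ natSquares xs

      ∑-squares : (xs : List A) → ∑[ x ∈ xs ] (f x * f x) ≡ + natSquares xs
      ∑-squares []       = refl
      ∑-squares (x ∷ xs) = begin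
        f x * f x + ∑[ y ∈ xs ] (f y * f y)          ≡⟨ cong₂ _+_ (square≡∣∣² (f x)) (∑-squares xs) ⟩
        + (∣ f x ∣ ℕ.* ∣ f x ∣) + + natSquares xs    ≡⟨ sym (ℤ.pos-+ _ (natSquares xs)) ⟩
        + natSquares (x ∷ xs)                         ∎

      squares≡0 : (xs : List A) → natSquares xs ≡ 0 → ∀ x → x ∈ xs → f x ≡ 0ℤ
      squares≡0 (x ∷ xs) s≡0 .x (here refl) with ℕ.m*n≡0⇒m≡0∨n≡0 ∣ f x ∣ (ℕ.m+n≡0⇒m≡0 _ s≡0)
      ... | inj₁ ∣fx∣≡0 = ℤ.∣i∣≡0⇒i≡0 ∣fx∣≡0
      ... | inj₂ ∣fx∣≡0 = ℤ.∣i∣≡0⇒i≡0 ∣fx∣≡0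
      squares≡0 (x ∷ xs) s≡0 y (there y∈) = squares≡0 xs (ℕ.m+n≡0⇒n≡0 (∣ f x ∣ ℕ.* ∣ f x ∣) s≡0) y y∈

  ∑-map : ∀ {A B : Set} (xs : List A) (h : A → B) (f : B → ℤ) → ∑ (map h xs) f ≡ ∑[ x ∈ xs ] f (h x)
  ∑-map []       h f = refl
  ∑-map (x ∷ xs) h f = cong (_+_ (f (h x))) (∑-map xs h f)

  ∑-concatMap : ∀ {A B : Set} (xs : List A) (F : A → List B) (f : B → ℤ) →
                ∑ (concatMap F xs) f ≡ ∑[ x ∈ xs ] ∑ (F x) f
  ∑-concatMap xs F f = trans (∑-concat (map F xs) f) (∑-map xs F (λ ys → ∑ ys f))

  ∑-comm : ∀ {A B : Set} (xs : List A) (ys : List B) (f : A → B → ℤ) →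
           ∑[ x ∈ xs ] ∑[ y ∈ ys ] f x y ≡ ∑[ y ∈ ys ] ∑[ x ∈ xs ] f x y
  ∑-comm []       ys f = sym (∑-zero ys (λ _ → 0ℤ) (λ _ _ → refl))
  ∑-comm (x ∷ xs) ys f = begin
    ∑ ys (f x) + ∑[ x′ ∈ xs ] ∑ ys (f x′)          ≡⟨ cong (_+_ (∑ ys (f x))) (∑-comm xs ys f) ⟩
    ∑ ys (f x) + ∑[ y ∈ ys ] ∑[ x′ ∈ xs ] f x′ y   ≡⟨ sym (∑-+ ys (f x) _) ⟩
    ∑[ y ∈ ys ] (f x y + ∑[ x′ ∈ xs ] f x′ y)      ∎

  ∑-*-∑ : ∀ {A B : Set} (xs : List A) (ys : List B) (f : A → ℤ) (g : B → ℤ) →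
          ∑ xs f * ∑ ys g ≡ ∑[ x ∈ xs ] ∑[ y ∈ ys ] (f x * g y)
  ∑-*-∑ xs ys f g = begin
    ∑ xs f * ∑ ys g                     ≡⟨ sym (∑-*ʳ xs (∑ ys g) f) ⟩
    ∑[ x ∈ xs ] (f x * ∑ ys g)          ≡⟨ ∑-cong xs (λ x _ → sym (∑-*ˡ ys (f x) g)) ⟩
    ∑[ x ∈ xs ] ∑[ y ∈ ys ] (f x * g y) ∎

  ∑-allFin-suc : ∀ n (f : Fin (suc n) → ℤ) → ∑ (allFin (suc n)) f ≡ f fzero + ∑[ i ∈ allFin n ] f (fsuc i)
  ∑-allFin-suc n f = cong (_+_ (f fzero)) (begin
    ∑ (tabulate fsuc) f            ≡⟨ cong (λ xs → ∑ xs f) (sym (List.map-tabulate (λ i → i) fsuc)) ⟩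
    ∑ (map fsuc (allFin n)) f      ≡⟨ ∑-map (allFin n) fsuc f ⟩
    ∑[ i ∈ allFin n ] f (fsuc i)   ∎)

module UniqueLists where

  open import Data.Nat as ℕ using (ℕ; _≤_)
  import Data.Nat.Properties as ℕ
  open import Data.List using (List; []; _∷_; _++_; length; concatMap)
  import Data.List.Properties as List
  open import Data.List.Membership.Propositional using (_∈_)
  open import Data.List.Membership.Propositional.Properties using (∈-∃++; ∈-++⁻; ∈-++⁺ˡ; ∈-++⁺ʳ)
  open import Data.List.Relation.Unary.Any using (here; there)
  open import Data.List.Relation.Unary.All as All using ()
  open import Data.List.Relation.Unary.AllPairs using (_∷_)
  open import Data.List.Relation.Unary.Unique.Propositional using (Unique)
  open import Data.List.Relation.Binary.Permutation.Propositional using (_↭_; prep; ↭-trans; ↭-refl; ↭-sym)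
  open import Data.List.Relation.Binary.Permutation.Propositional.Properties using (shift; ↭-length; ++-identityʳ)
  open import Data.Product using (∃; _,_)
  open import Data.Sum using (inj₁; inj₂)
  open import Data.Empty using (⊥-elim)
  open import Relation.Binary.PropositionalEquality using (_≡_; _≢_; refl; cong₂; sym; trans; subst; module ≡-Reasoning)

  module _ {A : Set} where

    ∈-remove : ∀ {x y : A} (xs ys : List A) → x ∈ xs ++ y ∷ ys → x ≢ y → x ∈ xs ++ ys
    ∈-remove xs ys x∈ x≢y with ∈-++⁻ xs x∈
    ... | inj₁ x∈xs         = ∈-++⁺ˡ x∈xs
    ... | inj₂ (here x≡y)   = ⊥-elim (x≢y x≡y)
    ... | inj₂ (there x∈ys) = ∈-++⁺ʳ xs x∈ys

    unique-⊆⇒↭-++ : (xs ys : List A) → Unique xs → (∀ x → x ∈ xs → x ∈ ys) → ∃ λ zs → ys ↭ xs ++ zs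
    unique-⊆⇒↭-++ []       ys _                xs⊆ys = ys , ↭-refl
    unique-⊆⇒↭-++ (x ∷ xs) ys (x∉xs ∷ unique) xs⊆ys with ∈-∃++ (xs⊆ys x (here refl))
    ... | ys₁ , ys₂ , refl with unique-⊆⇒↭-++ xs (ys₁ ++ ys₂) unique
                                  (λ y y∈ → ∈-remove ys₁ ys₂ (xs⊆ys y (there y∈)) (λ y≡x → All.lookup x∉xs y∈ (sym y≡x)))
    ...   | zs , p = zs , ↭-trans (shift x ys₁ ys₂) (prep x p)

    unique-⊆⇒length≤ : (xs ys : List A) → Unique xs → (∀ x → x ∈ xs → x ∈ ys) → length xs ≤ length ys
    unique-⊆⇒length≤ xs ys unique xs⊆ys with unique-⊆⇒↭-++ xs ys unique xs⊆ys
    ... | zs , p = subst (length xs ≤_) (sym (trans (↭-length p) (List.length-++ xs))) (ℕ.m≤m+n (length xs) (length zs))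

    unique-⊆⇒↭ : (xs ys : List A) → Unique xs → (∀ x → x ∈ xs → x ∈ ys) → length ys ≡ length xs → xs ↭ ys
    unique-⊆⇒↭ xs ys unique xs⊆ys same-length with unique-⊆⇒↭-++ xs ys unique xs⊆ys
    ... | []     , p = ↭-sym (↭-trans p (++-identityʳ xs))
    ... | z ∷ zs , p = ⊥-elim (ℕ.m+1+n≢m (length xs) (sym (trans (sym same-length) (trans (↭-length p) (List.length-++ xs)))))

  length-concatMap : ∀ {A B : Set} (F : A → List B) (l : ℕ) → (∀ x → length (F x) ≡ l) →
                     ∀ xs → length (concatMap F xs) ≡ length xs ℕ.* l
  length-concatMap F l lengths≡ []       = refl
  length-concatMap F l lengths≡ (x ∷ xs) = begin
    length (F x ++ concatMap F xs)           ≡⟨ List.length-++ (F x) ⟩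
    length (F x) ℕ.+ length (concatMap F xs) ≡⟨ cong₂ ℕ._+_ (lengths≡ x) (length-concatMap F l lengths≡ xs) ⟩
    l ℕ.+ length xs ℕ.* l                    ∎
    where open ≡-Reasoning

module Kernels where

  open FiniteSums
  open import Data.Integer using (ℤ; 0ℤ; _*_)
  open import Data.List using (List; map; concat; concatMap; allFin)
  open import Data.List.Membership.Propositional.Properties using (∈-map⁻)
  open import Data.Fin using (Fin)
  open import Data.Product using (_,_)
  open import Function using (case_of_)
  open import Data.List.Membership.Propositional using (_∈_)
  open import Data.List.Relation.Binary.Permutation.Propositional using (_↭_)
  open import Relation.Binary.PropositionalEquality using (_≡_; refl; cong; sym; trans; module ≡-Reasoning)
  open ≡-Reasoning

  module _ {A : Set} where

    kernel : List (A → ℤ) → A → A → ℤ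
    kernel Φ x y = ∑[ φ ∈ Φ ] (φ x * φ y)

    kernelSum : List (A → ℤ) → List A → ℤ
    kernelSum Φ xs = ∑[ x ∈ xs ] ∑[ y ∈ xs ] kernel Φ x y

    kernelSum≡∑-squares : (Φ : List (A → ℤ)) (xs : List A) → kernelSum Φ xs ≡ ∑[ φ ∈ Φ ] (∑ xs φ * ∑ xs φ)
    kernelSum≡∑-squares Φ xs = begin
      ∑[ x ∈ xs ] ∑[ y ∈ xs ] ∑[ φ ∈ Φ ] (φ x * φ y) ≡⟨ ∑-cong xs (λ x _ → ∑-comm xs Φ (λ y φ → φ x * φ y)) ⟩
      ∑[ x ∈ xs ] ∑[ φ ∈ Φ ] ∑[ y ∈ xs ] (φ x * φ y) ≡⟨ ∑-comm xs Φ _ ⟩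
      ∑[ φ ∈ Φ ] ∑[ x ∈ xs ] ∑[ y ∈ xs ] (φ x * φ y) ≡⟨ ∑-cong Φ (λ φ _ → sym (∑-*-∑ xs xs φ φ)) ⟩
      ∑[ φ ∈ Φ ] (∑ xs φ * ∑ xs φ)                  ∎

    kernelSum≡0⇒∑≡0 : (Φ : List (A → ℤ)) (xs : List A) → kernelSum Φ xs ≡ 0ℤ → ∀ φ → φ ∈ Φ → ∑ xs φ ≡ 0ℤ
    kernelSum≡0⇒∑≡0 Φ xs k≡0 = ∑-square≡0 Φ (∑ xs) (trans (sym (kernelSum≡∑-squares Φ xs)) k≡0)

    ∑≡0⇒kernelSum≡0 : (Φ : List (A → ℤ)) (xs : List A) → (∀ φ → φ ∈ Φ → ∑ xs φ ≡ 0ℤ) → kernelSum Φ xs ≡ 0ℤ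
    ∑≡0⇒kernelSum≡0 Φ xs ∑≡0 = trans (kernelSum≡∑-squares Φ xs)
      (∑-zero Φ _ (λ φ φ∈ → cong (λ s → s * s) (∑≡0 φ φ∈)))

    kernelSum-concat : (Φ : List (A → ℤ)) (xss : List (List A)) →
                       (∀ xs → xs ∈ xss → kernelSum Φ xs ≡ 0ℤ) → kernelSum Φ (concat xss) ≡ 0ℤ
    kernelSum-concat Φ xss parts≡0 = ∑≡0⇒kernelSum≡0 Φ (concat xss) (λ φ φ∈ →
      trans (∑-concat xss φ) (∑-zero xss (λ xs → ∑ xs φ) (λ xs xs∈ →
        kernelSum≡0⇒∑≡0 Φ xs (parts≡0 xs xs∈) φ φ∈)))

    kernelSum-↭ : (Φ : List (A → ℤ)) {xs ys : List A} → xs ↭ ys → kernelSum Φ xs ≡ kernelSum Φ ys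
    kernelSum-↭ Φ {xs} {ys} p = begin
      kernelSum Φ xs                  ≡⟨ kernelSum≡∑-squares Φ xs ⟩
      ∑[ φ ∈ Φ ] (∑ xs φ * ∑ xs φ)    ≡⟨ ∑-cong Φ (λ φ _ → cong (λ s → s * s) (∑-↭ φ p)) ⟩
      ∑[ φ ∈ Φ ] (∑ ys φ * ∑ ys φ)    ≡⟨ sym (kernelSum≡∑-squares Φ ys) ⟩
      kernelSum Φ ys                  ∎

  kernelSum-union : ∀ {A : Set} {f} (Φ : List (A → ℤ)) (xs : List A) (parts : Fin f → List A) →
                    xs ↭ concatMap parts (allFin f) → (∀ k → kernelSum Φ (parts k) ≡ 0ℤ) → kernelSum Φ xs ≡ 0ℤ
  kernelSum-union Φ xs parts xs↭ parts≡0 = trans (kernelSum-↭ Φ xs↭) (kernelSum-concat Φ (map parts (allFin _)) λ p p∈ →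
    case ∈-map⁻ parts p∈ of λ where (k , _ , refl) → parts≡0 k)

module SignVectors where

  open import Defs using (Word; hamming)
  open FiniteSums
  open Kernels
  open import Data.Bool using (Bool; true; false; if_then_else_)
  open import Data.Nat as ℕ using (ℕ; suc)
  open import Data.Integer using (ℤ; +_; -[1+_]; 0ℤ; 1ℤ; _+_; _*_; -_; _-_)
  import Data.Integer.Properties as ℤ
  import Data.List.Properties as List
  open import Data.Fin using (Fin; _≟_) renaming (zero to fzero; suc to fsuc)
  open import Data.List using (List; allFin; map; concatMap)
  open import Data.Vec using (_∷_; []; lookup)
  open import Relation.Nullary using (does; yes; no)
  open import Relation.Binary.PropositionalEquality using (_≡_; refl; cong; cong₂; sym; trans; module ≡-Reasoning)
  open import Data.Integer.Tactic.RingSolver using (solve-∀)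
  open ≡-Reasoning

  sign : Bool → ℤ
  sign false = 1ℤ
  sign true  = -[1+ 0 ]

  sign² : ∀ b → sign b * sign b ≡ 1ℤ
  sign² false = refl
  sign² true  = refl

  coordinate : ∀ {n} → Word n → Fin n → ℤ
  coordinate x i = sign (lookup x i)

  ⟨_,_⟩ : ∀ {n} → Word n → Word n → ℤ
  ⟨_,_⟩ {n} x y = ∑[ i ∈ allFin n ] (coordinate x i * coordinate y i)

  correlation : ℕ → ℕ → ℤ
  correlation n d = + n - + 2 * + d

  correlation-below : ∀ {n} d k → 2 ℕ.* d ℕ.+ k ≡ n → correlation n d ≡ + k
  correlation-below {n} d k eq = begin
    + n - + 2 * + d                 ≡⟨ cong (λ z → + z - + 2 * + d) (sym eq) ⟩
    + (2 ℕ.* d ℕ.+ k) - + 2 * + d   ≡⟨ cong (_- + 2 * + d) (trans (ℤ.pos-+ (2 ℕ.* d) k) (cong (_+ + k) (ℤ.pos-* 2 d))) ⟩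
    + 2 * + d + + k - + 2 * + d     ≡⟨ cancel (+ 2 * + d) (+ k) ⟩
    + k                             ∎
    where cancel : ∀ a b → a + b - a ≡ b
          cancel = solve-∀

  correlation-above : ∀ {n} d k → 2 ℕ.* d ≡ n ℕ.+ k → correlation n d ≡ - + k
  correlation-above {n} d k eq = begin
    + n - + 2 * + d                 ≡⟨ cong (λ z → + n - z) (trans (sym (ℤ.pos-* 2 d)) (trans (cong +_ eq) (ℤ.pos-+ n k))) ⟩
    + n - (+ n + + k)               ≡⟨ cancel (+ n) (+ k) ⟩
    - + k                           ∎
    where cancel : ∀ a b → a - (a + b) ≡ - b
          cancel = solve-∀

  ⟨,⟩≡correlation : ∀ {n} (x y : Word n) → ⟨ x , y ⟩ ≡ correlation n (hamming x y)
  ⟨,⟩≡correlation []      []      = refl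
  ⟨,⟩≡correlation {suc n} (a ∷ x) (b ∷ y) = begin
    ⟨ a ∷ x , b ∷ y ⟩                             ≡⟨ ∑-allFin-suc n (λ i → coordinate (a ∷ x) i * coordinate (b ∷ y) i) ⟩
    sign a * sign b + ⟨ x , y ⟩                   ≡⟨ cong (_+_ (sign a * sign b)) (⟨,⟩≡correlation x y) ⟩
    sign a * sign b + correlation n (hamming x y) ≡⟨ step a b ⟩
    correlation (suc n) (hamming (a ∷ x) (b ∷ y)) ∎
    where
    agree : ∀ (m d : ℤ) → 1ℤ + (m - + 2 * d) ≡ (1ℤ + m) - + 2 * d
    agree = solve-∀
    differ : ∀ (m d : ℤ) → -[1+ 0 ] + (m - + 2 * d) ≡ (1ℤ + m) - + 2 * (1ℤ + d)
    differ = solve-∀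
    step : ∀ a b → sign a * sign b + correlation n (hamming x y) ≡ correlation (suc n) (hamming (a ∷ x) (b ∷ y))
    step false false = agree (+ n) (+ hamming x y)
    step true  true  = agree (+ n) (+ hamming x y)
    step false true  = differ (+ n) (+ hamming x y)
    step true  false = differ (+ n) (+ hamming x y)

  kronecker : ∀ {n} → Fin n → Fin n → ℤ
  kronecker i j = if does (i ≟ j) then 1ℤ else 0ℤ

  ∑-kronecker : ∀ n (i : Fin n) → ∑[ j ∈ allFin n ] kronecker i j ≡ 1ℤ
  ∑-kronecker (suc n) fzero    = trans (∑-allFin-suc n (kronecker fzero)) (cong (_+_ 1ℤ) (∑-zero (allFin n) _ (λ _ _ → refl)))
  ∑-kronecker (suc n) (fsuc i) = trans (∑-allFin-suc n (kronecker (fsuc i))) (trans (ℤ.+-identityˡ _) (∑-kronecker n i))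

  ∑∑-kronecker : ∀ n → ∑[ i ∈ allFin n ] ∑[ j ∈ allFin n ] kronecker i j ≡ + n
  ∑∑-kronecker n = trans (∑-cong (allFin n) (λ i _ → ∑-kronecker n i)) (trans (∑-const (allFin n) 1ℤ)
    (trans (ℤ.*-identityʳ _) (cong +_ (List.length-tabulate {n = n} (λ i → i)))))

  module Features (n : ℕ) where

    I : List (Fin n)
    I = allFin n

    ⟨,⟩² : (x y : Word n) → ⟨ x , y ⟩ * ⟨ x , y ⟩ ≡
           ∑[ i ∈ I ] ∑[ j ∈ I ] ((coordinate x i * coordinate y i) * (coordinate x j * coordinate y j))
    ⟨,⟩² x y = ∑-*-∑ I I _ _

    linear : List (Word n → ℤ)
    linear = map (λ i x → coordinate x i) I

    -- The squares of coordinates are the constant 1, whose sum over a code never vanishes.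
    quadratic : List (Word n → ℤ)
    quadratic = concatMap (λ i → map (λ j x → if does (i ≟ j) then 0ℤ else coordinate x i * coordinate x j) I) I

    cubic : List (Word n → ℤ)
    cubic = concatMap (λ i → concatMap (λ j → map (λ k x → coordinate x i * coordinate x j * coordinate x k) I) I) I

    kernel-linear : ∀ x y → kernel linear x y ≡ correlation n (hamming x y)
    kernel-linear x y = trans (∑-map I _ _) (⟨,⟩≡correlation x y)

    kernel-quadratic : ∀ x y → kernel quadratic x y ≡ correlation n (hamming x y) * correlation n (hamming x y) - + n
    kernel-quadratic x y = begin
      kernel quadratic x y
        ≡⟨ +-cancelling (kernel quadratic x y) (+ n) ⟩
      kernel quadratic x y + + n - + n
        ≡⟨ cong (λ s → s + + n - + n) (trans (∑-concatMap I _ _) (∑-cong I (λ i _ → ∑-map I _ _))) ⟩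
      ∑[ i ∈ I ] ∑[ j ∈ I ] (q i j x * q i j y) + + n - + n
        ≡⟨ cong (λ s → ∑[ i ∈ I ] ∑[ j ∈ I ] (q i j x * q i j y) + s - + n) (sym (∑∑-kronecker n)) ⟩
      ∑[ i ∈ I ] ∑[ j ∈ I ] (q i j x * q i j y) + ∑[ i ∈ I ] ∑[ j ∈ I ] kronecker i j - + n
        ≡⟨ cong (_- + n) (sym (∑-+ I _ _)) ⟩
      ∑[ i ∈ I ] (∑[ j ∈ I ] (q i j x * q i j y) + ∑[ j ∈ I ] kronecker i j) - + n
        ≡⟨ cong (_- + n) (∑-cong I (λ i _ → sym (∑-+ I _ _))) ⟩
      ∑[ i ∈ I ] ∑[ j ∈ I ] (q i j x * q i j y + kronecker i j) - + n
        ≡⟨ cong (_- + n) (∑-cong I (λ i _ → ∑-cong I (λ j _ → pointwise i j))) ⟩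
      ∑[ i ∈ I ] ∑[ j ∈ I ] (a i * a j) - + n
        ≡⟨ cong (_- + n) (sym (⟨,⟩² x y)) ⟩
      ⟨ x , y ⟩ * ⟨ x , y ⟩ - + n
        ≡⟨ cong (λ s → s * s - + n) (⟨,⟩≡correlation x y) ⟩
      correlation n (hamming x y) * correlation n (hamming x y) - + n ∎
      where
      cx cy a : Fin n → ℤ
      cx = coordinate x
      cy = coordinate y
      a i = cx i * cy i
      q : Fin n → Fin n → Word n → ℤ
      q i j z = if does (i ≟ j) then 0ℤ else coordinate z i * coordinate z j
      +-cancelling : ∀ k m → k ≡ k + m - m
      +-cancelling = solve-∀
      diagonal : ∀ p r → p * p ≡ 1ℤ → r * r ≡ 1ℤ → 0ℤ * 0ℤ + 1ℤ ≡ (p * r) * (p * r)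
      diagonal p r p²≡1 r²≡1 = sym (trans (regroup p r) (cong₂ _*_ p²≡1 r²≡1))
        where regroup : ∀ p r → (p * r) * (p * r) ≡ p * p * (r * r)
              regroup = solve-∀
      regroup : ∀ p r u v → (p * u) * (r * v) + 0ℤ ≡ (p * r) * (u * v)
      regroup = solve-∀
      pointwise : ∀ i j → q i j x * q i j y + kronecker i j ≡ a i * a j
      pointwise i j with i ≟ j
      ... | yes refl = diagonal (cx i) (cy i) (sign² (lookup x i)) (sign² (lookup y i))
      ... | no _     = regroup (cx i) (cy i) (cx j) (cy j)

    kernel-cubic : ∀ x y → kernel cubic x y ≡ correlation n (hamming x y) * correlation n (hamming x y) * correlation n (hamming x y)
    kernel-cubic x y = begin
      kernel cubic x y
        ≡⟨ ∑-concatMap I _ _ ⟩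
      ∑[ i ∈ I ] ∑ (concatMap (λ j → map (λ k z → coordinate z i * coordinate z j * coordinate z k) I) I) (λ φ → φ x * φ y)
        ≡⟨ ∑-cong I (λ i _ → trans (∑-concatMap I _ _) (∑-cong I (λ j _ → ∑-map I _ _))) ⟩
      ∑[ i ∈ I ] ∑[ j ∈ I ] ∑[ k ∈ I ] ((cx i * cx j * cx k) * (cy i * cy j * cy k))
        ≡⟨ ∑-cong I (λ i _ → ∑-cong I (λ j _ → ∑-cong I (λ k _ → regroup (cx i) (cy i) (cx j) (cy j) (cx k) (cy k)))) ⟩
      ∑[ i ∈ I ] ∑[ j ∈ I ] ∑[ k ∈ I ] (a i * a j * a k)
        ≡⟨ ∑-cong I (λ i _ → ∑-cong I (λ j _ → ∑-*ˡ I (a i * a j) a)) ⟩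
      ∑[ i ∈ I ] ∑[ j ∈ I ] (a i * a j * ⟨ x , y ⟩)
        ≡⟨ ∑-cong I (λ i _ → ∑-*ʳ I _ _) ⟩
      ∑[ i ∈ I ] (∑[ j ∈ I ] (a i * a j) * ⟨ x , y ⟩)
        ≡⟨ ∑-*ʳ I _ _ ⟩
      ∑[ i ∈ I ] ∑[ j ∈ I ] (a i * a j) * ⟨ x , y ⟩
        ≡⟨ cong (_* ⟨ x , y ⟩) (sym (⟨,⟩² x y)) ⟩
      ⟨ x , y ⟩ * ⟨ x , y ⟩ * ⟨ x , y ⟩
        ≡⟨ cong (λ s → s * s * s) (⟨,⟩≡correlation x y) ⟩
      correlation n (hamming x y) * correlation n (hamming x y) * correlation n (hamming x y) ∎
      where
      cx cy a : Fin n → ℤ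
      cx = coordinate x
      cy = coordinate y
      a i = cx i * cy i
      regroup : ∀ p q r s u v → (p * r * u) * (q * s * v) ≡ (p * q) * (r * s) * (u * v)
      regroup = solve-∀

module DistanceDistributions where

  open import Defs using (Word; hamming; pairCount)
  open FiniteSums
  open Kernels
  open import Data.Bool using (true; false; if_then_else_)
  open import Data.Nat as ℕ using (ℕ; _≡ᵇ_; _≤_; z≤n; s≤s)
  import Data.Nat.Properties as ℕ
  open import Data.Nat.ListAction using (sum)
  open import Data.Integer using (ℤ; +_; 0ℤ; 1ℤ; _+_; _*_)
  import Data.Integer.Properties as ℤ
  open import Data.List using (List; []; _∷_; map; length)
  open import Data.List.Membership.Propositional using (_∈_; _∉_)
  open import Data.List.Relation.Unary.Any using (here; there)
  open import Data.List.Relation.Unary.All as All using ()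
  open import Data.List.Relation.Unary.AllPairs using (AllPairs; []; _∷_)
  open import Data.List.Relation.Unary.Unique.Propositional using (Unique)
  open import Data.Vec using ([]; _∷_)
  open import Data.Empty using (⊥-elim)
  open import Data.Bool.Properties using (T-≡)
  open import Function.Bundles using (Equivalence)
  open import Relation.Binary.PropositionalEquality using (_≡_; _≢_; refl; cong; sym; trans; subst; module ≡-Reasoning)
  open ≡-Reasoning

  hamming-refl : ∀ {n} (x : Word n) → hamming x x ≡ 0
  hamming-refl []          = refl
  hamming-refl (false ∷ x) = hamming-refl x
  hamming-refl (true ∷ x)  = hamming-refl x

  hamming≡0⇒≡ : ∀ {n} (x y : Word n) → hamming x y ≡ 0 → x ≡ y
  hamming≡0⇒≡ []          []          _ = refl
  hamming≡0⇒≡ (false ∷ x) (false ∷ y) h = cong (false ∷_) (hamming≡0⇒≡ x y h)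
  hamming≡0⇒≡ (true ∷ x)  (true ∷ y)  h = cong (true ∷_) (hamming≡0⇒≡ x y h)

  hamming≤n : ∀ {n} (x y : Word n) → hamming x y ≤ n
  hamming≤n []          []          = z≤n
  hamming≤n (false ∷ x) (false ∷ y) = ℕ.m≤n⇒m≤1+n (hamming≤n x y)
  hamming≤n (true ∷ x)  (true ∷ y)  = ℕ.m≤n⇒m≤1+n (hamming≤n x y)
  hamming≤n (false ∷ x) (true ∷ y)  = s≤s (hamming≤n x y)
  hamming≤n (true ∷ x)  (false ∷ y) = s≤s (hamming≤n x y)

  distanceSum : ∀ {n} → List (Word n) → (ℕ → ℤ) → ℤ
  distanceSum xs G = ∑[ x ∈ xs ] ∑[ y ∈ xs ] G (hamming x y)

  kernelSum≡distanceSum : ∀ {n} (Φ : List (Word n → ℤ)) (G : ℕ → ℤ) → (∀ x y → kernel Φ x y ≡ G (hamming x y)) →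
                          ∀ xs → kernelSum Φ xs ≡ distanceSum xs G
  kernelSum≡distanceSum Φ G kernel≡ xs = ∑-cong xs (λ x _ → ∑-cong xs (λ y _ → kernel≡ x y))

  distanceSum-const : ∀ {n} (xs : List (Word n)) → distanceSum xs (λ _ → 1ℤ) ≡ + length xs * + length xs
  distanceSum-const xs = trans (∑-cong xs (λ _ _ → trans (∑-const xs 1ℤ) (ℤ.*-identityʳ _))) (∑-const xs _)

  [_≡ᵇ_] : ℕ → ℕ → ℤ
  [ d ≡ᵇ s ] = if d ≡ᵇ s then 1ℤ else 0ℤ

  ≡ᵇ-refl : ∀ d → (d ≡ᵇ d) ≡ true
  ≡ᵇ-refl d = Equivalence.to T-≡ (ℕ.≡⇒≡ᵇ d d refl)

  [≡ᵇ]-refl : ∀ d → [ d ≡ᵇ d ] ≡ 1ℤ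
  [≡ᵇ]-refl d = cong (λ b → if b then 1ℤ else 0ℤ) (≡ᵇ-refl d)

  [≡ᵇ]-≢ : ∀ {d s} → d ≢ s → [ d ≡ᵇ s ] ≡ 0ℤ
  [≡ᵇ]-≢ {d} {s} d≢s with d ≡ᵇ s in eq
  ... | false = refl
  ... | true  = ⊥-elim (d≢s (ℕ.≡ᵇ⇒≡ d s (Equivalence.from T-≡ eq)))

  pairCount≡∑ : ∀ {n} (xs : List (Word n)) i → + pairCount xs i ≡ distanceSum xs (λ d → [ d ≡ᵇ i ])
  pairCount≡∑ xs i =
    trans (sum≡∑ _ xs) (∑-cong xs (λ x _ → trans (sum≡∑ _ xs) (∑-cong xs (λ y _ → cast (hamming x y ≡ᵇ i)))))
    where
    sum≡∑ : ∀ {B : Set} (g : B → ℕ) (ys : List B) → + sum (map g ys) ≡ ∑[ y ∈ ys ] (+ g y)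
    sum≡∑ g []       = refl
    sum≡∑ g (y ∷ ys) = trans (ℤ.pos-+ (g y) _) (cong (_+_ (+ g y)) (sum≡∑ g ys))
    cast : ∀ b → + (if b then 1 else 0) ≡ (if b then 1ℤ else 0ℤ)
    cast true  = refl
    cast false = refl

  distanceSum-decomposition : ∀ {n} (xs : List (Word n)) (S : List ℕ) → AllPairs _≢_ S →
    (∀ x y → x ∈ xs → y ∈ xs → hamming x y ∈ S) →
    ∀ G → distanceSum xs G ≡ ∑[ s ∈ S ] (+ pairCount xs s * G s)
  distanceSum-decomposition xs S distinct dist∈S G = begin
    distanceSum xs G
      ≡⟨ ∑-cong xs (λ x x∈ → ∑-cong xs (λ y y∈ → expand S distinct (hamming x y) (dist∈S x y x∈ y∈))) ⟩
    ∑[ x ∈ xs ] ∑[ y ∈ xs ] ∑[ s ∈ S ] ([ hamming x y ≡ᵇ s ] * G s)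
      ≡⟨ ∑-cong xs (λ x _ → ∑-comm xs S _) ⟩
    ∑[ x ∈ xs ] ∑[ s ∈ S ] ∑[ y ∈ xs ] ([ hamming x y ≡ᵇ s ] * G s)
      ≡⟨ ∑-comm xs S _ ⟩
    ∑[ s ∈ S ] ∑[ x ∈ xs ] ∑[ y ∈ xs ] ([ hamming x y ≡ᵇ s ] * G s)
      ≡⟨ ∑-cong S (λ s _ → trans (∑-cong xs (λ x _ → ∑-*ʳ xs (G s) _)) (∑-*ʳ xs (G s) _)) ⟩
    ∑[ s ∈ S ] (distanceSum xs (λ d → [ d ≡ᵇ s ]) * G s)
      ≡⟨ ∑-cong S (λ s _ → cong (_* G s) (sym (pairCount≡∑ xs s))) ⟩
    ∑[ s ∈ S ] (+ pairCount xs s * G s) ∎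
    where
    absent : ∀ S d → d ∉ S → ∑[ s ∈ S ] ([ d ≡ᵇ s ] * G s) ≡ 0ℤ
    absent S d d∉S = ∑-zero S _ (λ s s∈ → cong (_* G s) ([≡ᵇ]-≢ (λ d≡s → d∉S (subst (_∈ S) (sym d≡s) s∈))))
    expand : ∀ S → AllPairs _≢_ S → ∀ d → d ∈ S → G d ≡ ∑[ s ∈ S ] ([ d ≡ᵇ s ] * G s)
    expand (s ∷ S) (s≢S ∷ _) d (here refl) = begin
      G d                                   ≡⟨ sym (ℤ.*-identityˡ (G d)) ⟩
      1ℤ * G d                              ≡⟨ cong (_* G d) (sym ([≡ᵇ]-refl d)) ⟩
      [ d ≡ᵇ d ] * G d                      ≡⟨ sym (ℤ.+-identityʳ _) ⟩
      [ d ≡ᵇ d ] * G d + 0ℤ                 ≡⟨ cong (_+_ ([ d ≡ᵇ d ] * G d))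
                                                    (sym (absent S d (λ d∈ → All.lookup s≢S d∈ refl))) ⟩
      ∑[ s′ ∈ d ∷ S ] ([ d ≡ᵇ s′ ] * G s′)  ∎
    expand (s ∷ S) (s≢S ∷ distinct) d (there d∈) = begin
      G d                                   ≡⟨ expand S distinct d d∈ ⟩
      ∑[ s′ ∈ S ] ([ d ≡ᵇ s′ ] * G s′)      ≡⟨ sym (ℤ.+-identityˡ _) ⟩
      0ℤ + ∑[ s′ ∈ S ] ([ d ≡ᵇ s′ ] * G s′) ≡⟨ cong (λ z → z * G s + _)
                                                    (sym ([≡ᵇ]-≢ (λ d≡s → All.lookup s≢S (subst (_∈ S) d≡s d∈) refl))) ⟩
      ∑[ s′ ∈ s ∷ S ] ([ d ≡ᵇ s′ ] * G s′)  ∎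

  pairCount-occurring : ∀ {n} (xs : List (Word n)) x y → x ∈ xs → y ∈ xs → 1 ≤ pairCount xs (hamming x y)
  pairCount-occurring xs x y x∈ y∈ = ℕ.≤-trans inner (sum≥ _ xs x x∈)
    where
    sum≥ : ∀ {B : Set} (g : B → ℕ) (zs : List B) z → z ∈ zs → g z ≤ sum (map g zs)
    sum≥ g (z ∷ zs) .z (here refl) = ℕ.m≤m+n (g z) _
    sum≥ g (z ∷ zs) w  (there w∈)  = ℕ.≤-trans (sum≥ g zs w w∈) (ℕ.m≤n+m _ (g z))
    indicator : ℕ → ℕ
    indicator d = if d ≡ᵇ hamming x y then 1 else 0
    inner : 1 ≤ sum (map (λ y′ → indicator (hamming x y′)) xs)
    inner = ℕ.≤-trans (ℕ.≤-reflexive (cong (λ b → if b then 1 else 0) (sym (≡ᵇ-refl (hamming x y)))))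
                      (sum≥ (λ y′ → indicator (hamming x y′)) xs y y∈)

  pairCount-absent : ∀ {n} (xs : List (Word n)) j → (∀ x y → x ∈ xs → y ∈ xs → hamming x y ≢ j) → pairCount xs j ≡ 0
  pairCount-absent xs j never = ℤ.+-injective (trans (pairCount≡∑ xs j)
    (∑-zero xs _ (λ x x∈ → ∑-zero xs _ (λ y y∈ → [≡ᵇ]-≢ (never x y x∈ y∈)))))

  pairCount-0 : ∀ {n} (xs : List (Word n)) → Unique xs → pairCount xs 0 ≡ length xs
  pairCount-0 xs unique = ℤ.+-injective (begin
    + pairCount xs 0                          ≡⟨ pairCount≡∑ xs 0 ⟩
    distanceSum xs (λ d → [ d ≡ᵇ 0 ])         ≡⟨ ∑-cong xs (λ x x∈ → only-itself xs unique x x∈) ⟩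
    ∑[ _ ∈ xs ] 1ℤ                            ≡⟨ ∑-const xs 1ℤ ⟩
    + length xs * 1ℤ                          ≡⟨ ℤ.*-identityʳ _ ⟩
    + length xs                               ∎)
    where
    only-itself : ∀ ys → Unique ys → ∀ x → x ∈ ys → ∑[ y ∈ ys ] [ hamming x y ≡ᵇ 0 ] ≡ 1ℤ
    only-itself (z ∷ zs) (z∉zs ∷ _) x (here refl) rewrite hamming-refl x =
      cong (_+_ 1ℤ) (∑-zero zs _ (λ y y∈ → [≡ᵇ]-≢ (λ h → All.lookup z∉zs y∈ (hamming≡0⇒≡ x y h))))
    only-itself (z ∷ zs) (z∉zs ∷ unique) x (there x∈) = begin
      [ hamming x z ≡ᵇ 0 ] + ∑[ y ∈ zs ] [ hamming x y ≡ᵇ 0 ]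
        ≡⟨ cong (_+ _) ([≡ᵇ]-≢ (λ h → All.lookup z∉zs x∈ (sym (hamming≡0⇒≡ x z h)))) ⟩
      0ℤ + ∑[ y ∈ zs ] [ hamming x y ≡ᵇ 0 ]
        ≡⟨ ℤ.+-identityˡ _ ⟩
      ∑[ y ∈ zs ] [ hamming x y ≡ᵇ 0 ]
        ≡⟨ only-itself zs unique x x∈ ⟩
      1ℤ ∎

module Frequencies where

  open import Defs using (Word; pairCount; A; ℕ→ℚ; ell)
  open import Data.Nat as ℕ using (ℕ; suc; _≤_; NonZero)
  import Data.Nat.Properties as ℕ
  open import Data.Integer as ℤ using (ℤ; +_)
  import Data.Integer.Properties as ℤ
  open import Data.Rational as ℚ using (ℚ; toℚᵘ; 0ℚ; 1ℚ)
  import Data.Rational.Properties as ℚ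
  open import Data.Rational.Unnormalised as ℚᵘ using (ℚᵘ; mkℚᵘ; *≡*; _≃_; ↥_; ↧_; ↧ₙ_) renaming (_/_ to _/ᵘ_)
  import Data.Rational.Unnormalised.Properties as ℚᵘ
  open import Data.List using (List; _∷_; length)
  open import Relation.Binary.PropositionalEquality using (_≡_; cong; cong₂; sym; trans; module ≡-Reasoning)

  toℚᵘ-/ : ∀ p d .{{_ : NonZero d}} → toℚᵘ (p ℚ./ d) ≃ p /ᵘ d
  toℚᵘ-/ p (suc d) = ℚ.toℚᵘ-fromℚᵘ (mkℚᵘ p d)

  A≡⇒pairCount : ∀ {n} (xs : List (Word n)) i (r : ℤ) (d : ℕ) .{{_ : NonZero d}} {q : ℚ} → 1 ≤ length xs →
                 toℚᵘ q ≃ r /ᵘ d → A xs i ≡ q → + pairCount xs i ℤ.* + d ≡ r ℤ.* + length xs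
  A≡⇒pairCount (x ∷ xs) i r (suc d) _ q≃r/d A≡q
    with ℚᵘ.≃-trans (ℚᵘ.≃-sym (toℚᵘ-/ (+ pairCount (x ∷ xs) i) (suc (length xs))))
                    (ℚᵘ.≃-trans (ℚ.toℚᵘ-cong A≡q) q≃r/d)
  ... | *≡* eq = eq

  pairCount⇒A≡ : ∀ {n} (xs : List (Word n)) i (r : ℤ) (d : ℕ) .{{_ : NonZero d}} {q : ℚ} → 1 ≤ length xs →
                 toℚᵘ q ≃ r /ᵘ d → + pairCount xs i ℤ.* + d ≡ r ℤ.* + length xs → A xs i ≡ q
  pairCount⇒A≡ (x ∷ xs) i r (suc d) _ q≃r/d eq =
    ℚ.toℚᵘ-injective (ℚᵘ.≃-trans (toℚᵘ-/ (+ pairCount (x ∷ xs) i) (suc (length xs)))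
                                 (ℚᵘ.≃-trans (*≡* eq) (ℚᵘ.≃-sym q≃r/d)))

  A≡ℕ→ℚ⇒pairCount : ∀ {n} (xs : List (Word n)) i k → 1 ≤ length xs → A xs i ≡ ℕ→ℚ k → pairCount xs i ≡ k ℕ.* length xs
  A≡ℕ→ℚ⇒pairCount xs i k nonempty A≡k = ℤ.+-injective (begin
    + pairCount xs i            ≡⟨ sym (ℤ.*-identityʳ _) ⟩
    + pairCount xs i ℤ.* + 1    ≡⟨ A≡⇒pairCount xs i (+ k) 1 nonempty (toℚᵘ-/ (+ k) 1) A≡k ⟩
    + k ℤ.* + length xs         ≡⟨ sym (ℤ.pos-* k _) ⟩
    + (k ℕ.* length xs)         ∎)
    where open ≡-Reasoning

  A≡0⇒pairCount≡0 : ∀ {n} (xs : List (Word n)) i → 1 ≤ length xs → A xs i ≡ 0ℚ → pairCount xs i ≡ 0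
  A≡0⇒pairCount≡0 xs i nonempty A≡0 = A≡ℕ→ℚ⇒pairCount xs i 0 nonempty A≡0

  A≡1⇒pairCount≡length : ∀ {n} (xs : List (Word n)) i → 1 ≤ length xs → A xs i ≡ 1ℚ → pairCount xs i ≡ length xs
  A≡1⇒pairCount≡length xs i nonempty A≡1 = trans (A≡ℕ→ℚ⇒pairCount xs i 1 nonempty A≡1) (ℕ.*-identityˡ _)

  pairCount≡0⇒A≡0 : ∀ {n} (xs : List (Word n)) i → 1 ≤ length xs → pairCount xs i ≡ 0 → A xs i ≡ 0ℚ
  pairCount≡0⇒A≡0 xs i nonempty pc≡0 = pairCount⇒A≡ xs i (+ 0) 1 nonempty (toℚᵘ-/ (+ 0) 1)
    (trans (ℤ.*-identityʳ _) (cong +_ pc≡0))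

  pairCount≡length⇒A≡1 : ∀ {n} (xs : List (Word n)) i → 1 ≤ length xs → pairCount xs i ≡ length xs → A xs i ≡ 1ℚ
  pairCount≡length⇒A≡1 xs i nonempty pc≡l = pairCount⇒A≡ xs i (+ 1) 1 nonempty (toℚᵘ-/ (+ 1) 1)
    (trans (ℤ.*-identityʳ _) (trans (cong +_ pc≡l) (sym (ℤ.*-identityˡ _))))

  scale-* : ∀ (a : ℤ) (p : ℚᵘ) → (a /ᵘ 1) ℚᵘ.* p ≃ (a ℤ.* ↥ p) /ᵘ ↧ₙ p
  scale-* a (mkℚᵘ b d) = *≡* (cong (λ e → a ℤ.* b ℤ.* + e) (sym (ℕ.+-identityʳ (suc d))))

  scale-+ : ∀ (a : ℤ) (p : ℚᵘ) → (a /ᵘ 1) ℚᵘ.+ p ≃ (a ℤ.* ↧ p ℤ.+ ↥ p) /ᵘ ↧ₙ p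
  scale-+ a (mkℚᵘ b d) = *≡* (cong₂ (λ u e → (a ℤ.* + suc d ℤ.+ u) ℤ.* + e) (ℤ.*-identityʳ b) (sym (ℕ.+-identityʳ (suc d))))

  module _ (n a : ℕ) where

    private
      D : ℕ
      D = 2 ℕ.* suc a
      Δ ν : ℤ
      Δ = + (D ℕ.* D)
      ν = + n

    toℚᵘ-ell : toℚᵘ (ell n (suc a)) ≃ (ν ℤ.* ν) /ᵘ (D ℕ.* D)
    toℚᵘ-ell = ℚᵘ.≃-trans (ℚ.toℚᵘ-homo-* (ν ℚ./ D) (ν ℚ./ D)) (ℚᵘ.*-cong (toℚᵘ-/ ν D) (toℚᵘ-/ ν D))

    toℚᵘ-ℕ→ℚ*ell : ∀ k → toℚᵘ (ℕ→ℚ k ℚ.* ell n (suc a)) ≃ (+ k ℤ.* (ν ℤ.* ν)) /ᵘ (D ℕ.* D)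
    toℚᵘ-ℕ→ℚ*ell k = begin
      toℚᵘ (ℕ→ℚ k ℚ.* ell n (suc a))                ≈⟨ ℚ.toℚᵘ-homo-* (ℕ→ℚ k) (ell n (suc a)) ⟩
      toℚᵘ (ℕ→ℚ k) ℚᵘ.* toℚᵘ (ell n (suc a))        ≈⟨ ℚᵘ.*-cong (toℚᵘ-/ (+ k) 1) toℚᵘ-ell ⟩
      (+ k /ᵘ 1) ℚᵘ.* ((ν ℤ.* ν) /ᵘ (D ℕ.* D))     ≈⟨ scale-* (+ k) _ ⟩
      (+ k ℤ.* (ν ℤ.* ν)) /ᵘ (D ℕ.* D)             ∎
      where open ℚᵘ.≃-Reasoning

    toℚᵘ-middle-frequency : ∀ w k → toℚᵘ (ℕ→ℚ w ℚ.+ ℕ→ℚ k ℚ.* (ℕ→ℚ (2 ℕ.* n) ℚ.- ℕ→ℚ 2 ℚ.* ell n (suc a))) ≃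
               (+ w ℤ.* Δ ℤ.+ + k ℤ.* (+ (2 ℕ.* n) ℤ.* Δ ℤ.- + 2 ℤ.* (ν ℤ.* ν))) /ᵘ (D ℕ.* D)
    toℚᵘ-middle-frequency w k = begin
      toℚᵘ (ℕ→ℚ w ℚ.+ ℕ→ℚ k ℚ.* (ℕ→ℚ (2 ℕ.* n) ℚ.- two-ell))
        ≈⟨ ℚ.toℚᵘ-homo-+ (ℕ→ℚ w) _ ⟩
      toℚᵘ (ℕ→ℚ w) ℚᵘ.+ toℚᵘ (ℕ→ℚ k ℚ.* (ℕ→ℚ (2 ℕ.* n) ℚ.- two-ell))
        ≈⟨ ℚᵘ.+-cong (toℚᵘ-/ (+ w) 1)
                     (ℚᵘ.≃-trans (ℚ.toℚᵘ-homo-* (ℕ→ℚ k) _) (ℚᵘ.*-cong (toℚᵘ-/ (+ k) 1) bracket≃)) ⟩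
      (+ w /ᵘ 1) ℚᵘ.+ (+ k /ᵘ 1) ℚᵘ.* ((+ (2 ℕ.* n) /ᵘ 1) ℚᵘ.+ ℚᵘ.- ((+ 2 ℤ.* (ν ℤ.* ν)) /ᵘ (D ℕ.* D)))
        ≈⟨ ℚᵘ.+-congʳ (+ w /ᵘ 1) (ℚᵘ.≃-trans (ℚᵘ.*-congˡ {+ k /ᵘ 1} (scale-+ (+ (2 ℕ.* n)) _)) (scale-* (+ k) _)) ⟩
      (+ w /ᵘ 1) ℚᵘ.+ (+ k ℤ.* (+ (2 ℕ.* n) ℤ.* Δ ℤ.- + 2 ℤ.* (ν ℤ.* ν))) /ᵘ (D ℕ.* D)
        ≈⟨ scale-+ (+ w) _ ⟩
      (+ w ℤ.* Δ ℤ.+ + k ℤ.* (+ (2 ℕ.* n) ℤ.* Δ ℤ.- + 2 ℤ.* (ν ℤ.* ν))) /ᵘ (D ℕ.* D) ∎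
      where
      open ℚᵘ.≃-Reasoning
      two-ell : ℚ
      two-ell = ℕ→ℚ 2 ℚ.* ell n (suc a)
      bracket≃ : toℚᵘ (ℕ→ℚ (2 ℕ.* n) ℚ.- two-ell) ≃
                 (+ (2 ℕ.* n) /ᵘ 1) ℚᵘ.+ ℚᵘ.- ((+ 2 ℤ.* (ν ℤ.* ν)) /ᵘ (D ℕ.* D))
      bracket≃ = ℚᵘ.≃-trans (ℚ.toℚᵘ-homo-+ (ℕ→ℚ (2 ℕ.* n)) _)
        (ℚᵘ.+-cong (toℚᵘ-/ (+ (2 ℕ.* n)) 1) (ℚᵘ.≃-trans (ℚ.toℚᵘ-homo‿- two-ell) (ℚᵘ.-‿cong (toℚᵘ-ℕ→ℚ*ell 2))))

module Moments where

  open import Data.Integer using (ℤ; +_; 0ℤ; 1ℤ; _+_; _*_; -_; _-_)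
  import Data.Integer.Properties as ℤ
  open import Data.Product using (_×_; _,_; proj₁; proj₂)
  open import Data.Sum using (inj₁; inj₂)
  open import Data.Empty using (⊥-elim)
  open import Relation.Binary.PropositionalEquality using (_≡_; _≢_; refl; cong; cong₂; sym; trans; module ≡-Reasoning)
  open import Data.Integer.Tactic.RingSolver using (solve-∀)
  open ≡-Reasoning

  nonzero-product : ∀ {x y} → x ≢ 0ℤ → y ≢ 0ℤ → x * y ≢ 0ℤ
  nonzero-product {x} x≢0 y≢0 xy≡0 with ℤ.i*j≡0⇒i≡0∨j≡0 x xy≡0
  ... | inj₁ x≡0 = x≢0 x≡0
  ... | inj₂ y≡0 = y≢0 y≡0

  cancel-nonzero : ∀ {x} y → x ≢ 0ℤ → x * y ≡ 0ℤ → y ≡ 0ℤ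
  cancel-nonzero {x} y x≢0 xy≡0 with ℤ.i*j≡0⇒i≡0∨j≡0 x xy≡0
  ... | inj₁ x≡0 = ⊥-elim (x≢0 x≡0)
  ... | inj₂ y≡0 = y≡0

  -- Eliminating u leaves δ (ν² - δ²) v = 0.
  odd-moments-vanish : ∀ (u v ν δ : ℤ) → ν ≢ 0ℤ → δ * (ν * ν - δ * δ) ≢ 0ℤ →
    u * ν + v * δ ≡ 0ℤ → u * (ν * ν * ν) + v * (δ * δ * δ) ≡ 0ℤ → u ≡ 0ℤ × v ≡ 0ℤ
  odd-moments-vanish u v ν δ ν≢0 δ[ν²-δ²]≢0 first third = u≡0 , v≡0
    where
    eliminate-u : ∀ u v ν δ → (δ * (ν * ν - δ * δ)) * v ≡ ν * ν * (u * ν + v * δ) - (u * (ν * ν * ν) + v * (δ * δ * δ))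
    eliminate-u = solve-∀
    vanish : ∀ a → a * 0ℤ - 0ℤ ≡ 0ℤ
    vanish = solve-∀
    v≡0 : v ≡ 0ℤ
    v≡0 = cancel-nonzero v δ[ν²-δ²]≢0 (begin
      (δ * (ν * ν - δ * δ)) * v                                    ≡⟨ eliminate-u u v ν δ ⟩
      ν * ν * (u * ν + v * δ) - (u * (ν * ν * ν) + v * (δ * δ * δ)) ≡⟨ cong₂ (λ p q → ν * ν * p - q) first third ⟩
      ν * ν * 0ℤ - 0ℤ                                              ≡⟨ vanish (ν * ν) ⟩
      0ℤ                                                           ∎)
    u≡0 : u ≡ 0ℤ
    u≡0 = cancel-nonzero u ν≢0 (begin
      ν * u          ≡⟨ ℤ.*-comm ν u ⟩
      u * ν          ≡⟨ sym (ℤ.+-identityʳ (u * ν)) ⟩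
      u * ν + 0ℤ     ≡⟨ cong (λ w → u * ν + w * δ) (sym v≡0) ⟩
      u * ν + v * δ  ≡⟨ first ⟩
      0ℤ             ∎)

  antisymmetric-moment : ∀ c P M Q N x y → c * x + (P * y + (M * 0ℤ + (Q * - y + (N * - x + 0ℤ)))) ≡ (c - N) * x + (P - Q) * y
  antisymmetric-moment = solve-∀

  cube-neg : ∀ x → - x * - x * - x ≡ - (x * x * x)
  cube-neg = solve-∀

  symmetric-zeroth-moment : ∀ c P M →
    M - (c * c - + 2 * c - + 2 * P) ≡ (c * 1ℤ + (P * 1ℤ + (M * 1ℤ + (P * 1ℤ + (c * 1ℤ + 0ℤ))))) - c * c
  symmetric-zeroth-moment = solve-∀

  symmetric-second-moment : ∀ c P M ν δ → + 2 * P * (δ * δ) - ν * c * (c - + 2 * ν) ≡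
    (c * (ν * ν - ν) + (P * (δ * δ - ν) + (M * (0ℤ * 0ℤ - ν) + (P * (- δ * - δ - ν) + (c * (- ν * - ν - ν) + 0ℤ)))))
      + ν * (M - (c * c - + 2 * c - + 2 * P))
  symmetric-second-moment = solve-∀

  -- ∑ₛ cₛ φ(ρₛ) for the numbers c, P, M, Q, N of ordered pairs at distances 0, n/2 - α, n/2, n/2 + α, n,
  -- whose correlations n - 2d are ν = n, δ = 2α, 0, -δ, -ν.
  fivePointMoment : (c P M Q N ν δ : ℤ) → (ℤ → ℤ) → ℤ
  fivePointMoment c P M Q N ν δ φ = c * φ ν + (P * φ δ + (M * φ 0ℤ + (Q * φ (- δ) + (N * φ (- ν) + 0ℤ))))

  five-point-distribution : ∀ c P M Q N ν δ → ν ≢ 0ℤ → δ * (ν * ν - δ * δ) ≢ 0ℤ →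
    fivePointMoment c P M Q N ν δ (λ _ → 1ℤ) ≡ c * c →
    fivePointMoment c P M Q N ν δ (λ z → z) ≡ 0ℤ →
    fivePointMoment c P M Q N ν δ (λ z → z * z - ν) ≡ 0ℤ →
    fivePointMoment c P M Q N ν δ (λ z → z * z * z) ≡ 0ℤ →
    N ≡ c × Q ≡ P × M ≡ c * c - + 2 * c - + 2 * P × + 2 * P * (δ * δ) ≡ ν * c * (c - + 2 * ν)
  five-point-distribution c P M Q N ν δ ν≢0 δ[ν²-δ²]≢0 zeroth first second third = N≡c , Q≡P , M≡ , P≡
    where
    odd-vanish : c - N ≡ 0ℤ × P - Q ≡ 0ℤ
    odd-vanish = odd-moments-vanish (c - N) (P - Q) ν δ ν≢0 δ[ν²-δ²]≢0
      (trans (sym (antisymmetric-moment c P M Q N ν δ)) first)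
      (trans (sym (trans (cong₂ (λ a b → c * (ν * ν * ν) + (P * (δ * δ * δ) + (M * 0ℤ + (Q * a + (N * b + 0ℤ)))))
                                (cube-neg δ) (cube-neg ν))
                         (antisymmetric-moment c P M Q N _ _))) third)
    N≡c : N ≡ c
    N≡c = sym (ℤ.i-j≡0⇒i≡j c N (proj₁ odd-vanish))
    Q≡P : Q ≡ P
    Q≡P = sym (ℤ.i-j≡0⇒i≡j P Q (proj₂ odd-vanish))
    symmetric : ∀ φ → fivePointMoment c P M Q N ν δ φ ≡ fivePointMoment c P M P c ν δ φ
    symmetric φ = cong₂ (λ q n → fivePointMoment c P M q n ν δ φ) Q≡P N≡c
    M≡ : M ≡ c * c - + 2 * c - + 2 * P
    M≡ = ℤ.i-j≡0⇒i≡j _ _ (begin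
      M - (c * c - + 2 * c - + 2 * P)                           ≡⟨ symmetric-zeroth-moment c P M ⟩
      fivePointMoment c P M P c ν δ (λ _ → 1ℤ) - c * c          ≡⟨ cong (_- c * c) (trans (sym (symmetric (λ _ → 1ℤ))) zeroth) ⟩
      c * c - c * c                                             ≡⟨ ℤ.+-inverseʳ (c * c) ⟩
      0ℤ                                                        ∎)
    P≡ : + 2 * P * (δ * δ) ≡ ν * c * (c - + 2 * ν)
    P≡ = ℤ.i-j≡0⇒i≡j _ _ (begin
      + 2 * P * (δ * δ) - ν * c * (c - + 2 * ν)
        ≡⟨ symmetric-second-moment c P M ν δ ⟩
      fivePointMoment c P M P c ν δ (λ z → z * z - ν) + ν * (M - (c * c - + 2 * c - + 2 * P))
        ≡⟨ cong₂ (λ p q → p + ν * q) (trans (sym (symmetric (λ z → z * z - ν))) second)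
                 (trans (cong (_- (c * c - + 2 * c - + 2 * P)) M≡) (ℤ.+-inverseʳ (c * c - + 2 * c - + 2 * P))) ⟩
      0ℤ + ν * 0ℤ
        ≡⟨ trans (ℤ.+-identityˡ _) (ℤ.*-zeroʳ ν) ⟩
      0ℤ ∎)

  union-side-count : ∀ P c ν δ F Δ → c ≡ + 2 * (1ℤ + F) * ν → Δ ≡ δ * δ →
    + 2 * P * (δ * δ) ≡ ν * c * (c - + 2 * ν) → P * Δ ≡ F * (ν * ν) * c
  union-side-count P _ ν δ F _ refl refl 2Pδ²≡ = ℤ.*-cancelˡ-≡ (+ 2) _ _ (begin
    + 2 * (P * (δ * δ))         ≡⟨ sym (ℤ.*-assoc (+ 2) P (δ * δ)) ⟩
    + 2 * P * (δ * δ)           ≡⟨ 2Pδ²≡ ⟩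
    ν * c * (c - + 2 * ν)       ≡⟨ expand ν F ⟩
    + 2 * (F * (ν * ν) * c)     ∎)
    where
    c : ℤ
    c = + 2 * (1ℤ + F) * ν
    expand : ∀ ν F → ν * (+ 2 * (1ℤ + F) * ν) * (+ 2 * (1ℤ + F) * ν - + 2 * ν) ≡ + 2 * (F * (ν * ν) * (+ 2 * (1ℤ + F) * ν))
    expand = solve-∀

  union-mid-count : ∀ M P c ν δ F W N₂ Δ → c ≡ + 2 * (1ℤ + F) * ν → W ≡ + 2 * ν - + 2 → N₂ ≡ + 2 * ν → Δ ≡ δ * δ →
    M ≡ c * c - + 2 * c - + 2 * P → P * Δ ≡ F * (ν * ν) * c → M * Δ ≡ (W * Δ + F * (N₂ * Δ - + 2 * (ν * ν))) * c
  union-mid-count _ P _ ν δ F _ _ _ refl refl refl refl refl Pδ²≡ = ℤ.i-j≡0⇒i≡j _ _ (begin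
    (c * c - + 2 * c - + 2 * P) * (δ * δ) - ((+ 2 * ν - + 2) * (δ * δ) + F * (+ 2 * ν * (δ * δ) - + 2 * (ν * ν))) * c
      ≡⟨ expand P ν δ F ⟩
    - (+ 2 * (P * (δ * δ) - F * (ν * ν) * c))
      ≡⟨ cong (λ z → - (+ 2 * (z - F * (ν * ν) * c))) Pδ²≡ ⟩
    - (+ 2 * (F * (ν * ν) * c - F * (ν * ν) * c))
      ≡⟨ cong (λ z → - (+ 2 * z)) (ℤ.+-inverseʳ (F * (ν * ν) * c)) ⟩
    0ℤ ∎)
    where
    c : ℤ
    c = + 2 * (1ℤ + F) * ν
    expand : ∀ P ν δ F → let c = + 2 * (1ℤ + F) * ν in
      (c * c - + 2 * c - + 2 * P) * (δ * δ) - ((+ 2 * ν - + 2) * (δ * δ) + F * (+ 2 * ν * (δ * δ) - + 2 * (ν * ν))) * c ≡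
      - (+ 2 * (P * (δ * δ) - F * (ν * ν) * c))
    expand = solve-∀

  -- the same for ordered pairs at distances 0, n/2, n, whose correlations are ν, 0, -ν
  threePointMoment : (l w ν : ℤ) → (ℤ → ℤ) → ℤ
  threePointMoment l w ν φ = l * φ ν + (w * φ 0ℤ + (l * φ (- ν) + 0ℤ))

  three-point-size : ∀ l W ν → l ≢ 0ℤ → threePointMoment l (W * l) ν (λ _ → 1ℤ) ≡ l * l → l ≡ W + + 2
  three-point-size l W ν l≢0 count = ℤ.i-j≡0⇒i≡j _ _ (cancel-nonzero _ l≢0 (begin
    l * (l - (W + + 2))                                    ≡⟨ expand l W ⟩
    l * l - (l * 1ℤ + (W * l * 1ℤ + (l * 1ℤ + 0ℤ)))        ≡⟨ cong (_-_ (l * l)) count ⟩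
    l * l - l * l                                          ≡⟨ ℤ.+-inverseʳ (l * l) ⟩
    0ℤ                                                     ∎))
    where
    expand : ∀ l W → l * (l - (W + + 2)) ≡ l * l - (l * 1ℤ + (W * l * 1ℤ + (l * 1ℤ + 0ℤ)))
    expand = solve-∀

  three-point-moments : ∀ l W ν → W ≡ + 2 * ν - + 2 →
    threePointMoment l (W * l) ν (λ z → z) ≡ 0ℤ ×
    threePointMoment l (W * l) ν (λ z → z * z - ν) ≡ 0ℤ ×
    threePointMoment l (W * l) ν (λ z → z * z * z) ≡ 0ℤ
  three-point-moments l _ ν refl = first l ν , second l ν , third l ν
    where
    first : ∀ l ν → l * ν + ((+ 2 * ν - + 2) * l * 0ℤ + (l * - ν + 0ℤ)) ≡ 0ℤ
    first = solve-∀
    second : ∀ l ν → l * (ν * ν - ν) + ((+ 2 * ν - + 2) * l * (0ℤ * 0ℤ - ν) + (l * (- ν * - ν - ν) + 0ℤ)) ≡ 0ℤ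
    second = solve-∀
    third : ∀ l ν → l * (ν * ν * ν) + ((+ 2 * ν - + 2) * l * (0ℤ * 0ℤ * 0ℤ) + (l * (- ν * - ν * - ν) + 0ℤ)) ≡ 0ℤ
    third = solve-∀

  two-point-size : ∀ l → l ≢ 0ℤ → l * 1ℤ + (l * 1ℤ + 0ℤ) ≡ l * l → l ≡ + 2
  two-point-size l l≢0 count = ℤ.i-j≡0⇒i≡j _ _ (cancel-nonzero _ l≢0 (begin
    l * (l - + 2)                       ≡⟨ expand l ⟩
    l * l - (l * 1ℤ + (l * 1ℤ + 0ℤ))    ≡⟨ cong (_-_ (l * l)) count ⟩
    l * l - l * l                       ≡⟨ ℤ.+-inverseʳ (l * l) ⟩
    0ℤ                                  ∎))
    where
    expand : ∀ l → l * (l - + 2) ≡ l * l - (l * 1ℤ + (l * 1ℤ + 0ℤ))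
    expand = solve-∀

module HadamardCodes where

  open import Defs
  open Kernels
  open SignVectors
  open DistanceDistributions
  open Frequencies
  open UniqueLists
  open Moments
  open import Data.Nat as ℕ using (ℕ; zero; suc; _+_; _*_; _∸_; _≤_; _<_; z≤n; s≤s; _≟_)
  import Data.Nat.Properties as ℕ
  open import Data.Integer as ℤ using (ℤ; +_; 0ℤ; 1ℤ)
  import Data.Integer.Properties as ℤ
  open import Data.Rational using (0ℚ; 1ℚ) renaming (_+_ to _+ℚ_; _*_ to _*ℚ_; _-_ to _-ℚ_)
  open import Data.Fin using (Fin)
  open import Data.List using (List; []; _∷_; length; allFin; concatMap)
  import Data.List.Properties as List
  open import Data.List.Membership.Propositional using (_∈_)
  open import Data.List.Membership.Propositional.Properties using (∈-concat⁺′; ∈-map⁺; ∈-allFin)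
  open import Data.List.Relation.Unary.Any using (here; there)
  open import Data.List.Relation.Unary.AllPairs as AllPairs using (AllPairs)
  open import Data.List.Relation.Unary.Linked using (Linked; _∷_; [-])
  open import Data.List.Relation.Unary.Linked.Properties using (Linked⇒AllPairs)
  open import Data.List.Relation.Unary.Unique.Propositional using (Unique)
  open import Data.List.Relation.Binary.Permutation.Propositional using (_↭_)
  open import Data.Product using (_×_; _,_; ∃; proj₁; proj₂)
  open import Data.Sum using (_⊎_; inj₁; inj₂)
  open import Data.Empty using (⊥; ⊥-elim)
  open import Relation.Nullary using (yes; no)
  open import Relation.Binary.PropositionalEquality using (_≡_; _≢_; refl; cong; cong₂; sym; trans; subst; module ≡-Reasoning)
  open import Function.Bundles using (_⇔_; Equivalence)
  open import Data.Integer.Tactic.RingSolver using (solve-∀)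

  HadamardDistribution : ∀ {n} → List (Word n) → Set
  HadamardDistribution {n} X =
    A X 0 ≡ 1ℚ × (∀ j → 2 * j ≡ n → A X j ≡ ℕ→ℚ (2 * n ∸ 2)) × A X n ≡ 1ℚ ×
    (∀ j → j ≢ 0 → 2 * j ≢ n → j ≢ n → A X j ≡ 0ℚ)

  ascending⇒distinct : ∀ {ds : List ℕ} → Linked _<_ ds → AllPairs _≢_ ds
  ascending⇒distinct ascending = AllPairs.map ℕ.<⇒≢ (Linked⇒AllPairs ℕ.<-trans ascending)

  pos≢0 : ∀ {k} → 1 ≤ k → + k ≢ 0ℤ
  pos≢0 {suc k} _ ()

  pos-2n∸2 : ∀ {n} → 1 ≤ n → + (2 * n ∸ 2) ≡ + 2 ℤ.* + n ℤ.- + 2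
  pos-2n∸2 {n} 1≤n = begin
    + (2 * n ∸ 2)                 ≡⟨ shift (+ (2 * n ∸ 2)) (+ 2) ⟩
    + (2 * n ∸ 2) ℤ.+ + 2 ℤ.- + 2 ≡⟨ cong (ℤ._- + 2) (sym (ℤ.pos-+ (2 * n ∸ 2) 2)) ⟩
    + (2 * n ∸ 2 + 2) ℤ.- + 2     ≡⟨ cong (λ k → + k ℤ.- + 2) (ℕ.m∸n+n≡m (ℕ.*-monoʳ-≤ 2 1≤n)) ⟩
    + (2 * n) ℤ.- + 2             ≡⟨ cong (ℤ._- + 2) (ℤ.pos-* 2 n) ⟩
    + 2 ℤ.* + n ℤ.- + 2           ∎
    where
    open ≡-Reasoning
    shift : ∀ a b → a ≡ a ℤ.+ b ℤ.- b
    shift = solve-∀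

  ∈⇒nonempty : ∀ {A : Set} {x : A} {xs} → x ∈ xs → 1 ≤ length xs
  ∈⇒nonempty (here _)  = s≤s z≤n
  ∈⇒nonempty (there _) = s≤s z≤n

  A≢0-at-occurring-distance : ∀ {n} (X : List (Word n)) {x y} → x ∈ X → y ∈ X → A X (hamming x y) ≢ 0ℚ
  A≢0-at-occurring-distance X {x} {y} x∈ y∈ A≡0
    with ℕ.≤-trans (pairCount-occurring X x y x∈ y∈) (ℕ.≤-reflexive (A≡0⇒pairCount≡0 X _ (∈⇒nonempty x∈) A≡0))
  ... | ()

  hadamard-nonempty : ∀ {n} (X : List (Word n)) → HadamardDistribution X → 1 ≤ length X
  hadamard-nonempty []      (() , _)
  hadamard-nonempty (_ ∷ _) _ = s≤s z≤n

  hadamard-odd-length : ∀ {n} (X : List (Word n)) → Unique X → 1 ≤ n → (∀ j → 2 * j ≢ n) →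
                        HadamardDistribution X → length X ≡ 2
  hadamard-odd-length {n} X unique 1≤n odd profile@(_ , _ , A[n]≡1 , A≡0) =
    ℤ.+-injective (two-point-size (+ length X) (pos≢0 nonempty) (begin
      + length X ℤ.* 1ℤ ℤ.+ (+ length X ℤ.* 1ℤ ℤ.+ 0ℤ)
        ≡⟨ cong₂ (λ a b → a ℤ.* 1ℤ ℤ.+ (b ℤ.* 1ℤ ℤ.+ 0ℤ)) (cong +_ (sym (pairCount-0 X unique)))
                                                          (cong +_ (sym (A≡1⇒pairCount≡length X n nonempty A[n]≡1))) ⟩
      + pairCount X 0 ℤ.* 1ℤ ℤ.+ (+ pairCount X n ℤ.* 1ℤ ℤ.+ 0ℤ)
        ≡⟨ sym (distanceSum-decomposition X (0 ∷ n ∷ []) (ascending⇒distinct (1≤n ∷ [-])) distances _) ⟩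
      distanceSum X (λ _ → 1ℤ)
        ≡⟨ distanceSum-const X ⟩
      + length X ℤ.* + length X ∎))
    where
    open ≡-Reasoning
    nonempty : 1 ≤ length X
    nonempty = hadamard-nonempty X profile
    distances : ∀ x y → x ∈ X → y ∈ X → hamming x y ∈ 0 ∷ n ∷ []
    distances x y x∈ y∈ with hamming x y ≟ 0 | hamming x y ≟ n
    ... | yes d≡0 | _       = here d≡0
    ... | no _    | yes d≡n = there (here d≡n)
    ... | no d≢0  | no d≢n  = ⊥-elim (A≢0-at-occurring-distance X x∈ y∈ (A≡0 _ d≢0 (odd (hamming x y)) d≢n))

  module _ {n m : ℕ} (X : List (Word n)) (unique : Unique X) (0<m : 0 < m) (2m≡n : 2 * m ≡ n)
           (profile : HadamardDistribution X) where

    private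
      l W : ℕ
      l = length X
      W = 2 * n ∸ 2
      nonempty : 1 ≤ l
      nonempty = hadamard-nonempty X profile
      1≤n : 1 ≤ n
      1≤n = subst (1 ≤_) 2m≡n (ℕ.≤-trans 0<m (ℕ.m≤m+n m _))

    hadamard-distances : ∀ x y → x ∈ X → y ∈ X → hamming x y ∈ 0 ∷ m ∷ n ∷ []
    hadamard-distances x y x∈ y∈ with hamming x y ≟ 0 | hamming x y ≟ m | hamming x y ≟ n
    ... | yes d≡0 | _       | _       = here d≡0
    ... | no _    | yes d≡m | _       = there (here d≡m)
    ... | no _    | no _    | yes d≡n = there (there (here d≡n))
    ... | no d≢0  | no d≢m  | no d≢n  = ⊥-elim (A≢0-at-occurring-distance X x∈ y∈ (proj₂ (proj₂ (proj₂ profile)) _ d≢0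
      (λ 2d≡n → d≢m (ℕ.*-cancelˡ-≡ _ _ 2 (trans 2d≡n (sym 2m≡n)))) d≢n))

    hadamard-moment : ∀ φ → distanceSum X (λ d → φ (correlation n d)) ≡ threePointMoment (+ l) (+ W ℤ.* + l) (+ n) φ
    hadamard-moment φ = trans (distanceSum-decomposition X (0 ∷ m ∷ n ∷ []) (ascending⇒distinct (0<m ∷ m<n ∷ [-])) hadamard-distances _)
      (cong₂ ℤ._+_ (cong₂ ℤ._*_ pc₀ (cong φ corr₀))
      (cong₂ ℤ._+_ (cong₂ ℤ._*_ pcₘ (cong φ corrₘ))
      (cong₂ ℤ._+_ (cong₂ ℤ._*_ pcₙ (cong φ corrₙ)) refl)))
      where
      m<n : m < n
      m<n = subst (m <_) 2m≡n (subst (m <_) (cong (_+_ m) (sym (ℕ.+-identityʳ m))) (ℕ.m<m+n m 0<m))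
      pc₀ : + pairCount X 0 ≡ + l
      pc₀ = cong +_ (pairCount-0 X unique)
      pcₘ : + pairCount X m ≡ + W ℤ.* + l
      pcₘ = trans (cong +_ (A≡ℕ→ℚ⇒pairCount X m W nonempty (proj₁ (proj₂ profile) m 2m≡n))) (ℤ.pos-* W l)
      pcₙ : + pairCount X n ≡ + l
      pcₙ = cong +_ (A≡1⇒pairCount≡length X n nonempty (proj₁ (proj₂ (proj₂ profile))))
      corr₀ : correlation n 0 ≡ + n
      corr₀ = correlation-below 0 n refl
      corrₘ : correlation n m ≡ 0ℤ
      corrₘ = correlation-below m 0 (trans (ℕ.+-identityʳ _) 2m≡n)
      corrₙ : correlation n n ≡ ℤ.- + n
      corrₙ = correlation-above n n (cong (_+_ n) (ℕ.+-identityʳ n))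

    hadamard-length : length X ≡ 2 * n
    hadamard-length = ℤ.+-injective (begin
      + l             ≡⟨ three-point-size (+ l) (+ W) (+ n) (pos≢0 nonempty)
                           (trans (sym (hadamard-moment (λ _ → 1ℤ))) (distanceSum-const X)) ⟩
      + W ℤ.+ + 2     ≡⟨ sym (ℤ.pos-+ W 2) ⟩
      + (W + 2)       ≡⟨ cong +_ (ℕ.m∸n+n≡m (ℕ.*-monoʳ-≤ 2 1≤n)) ⟩
      + (2 * n)       ∎)
      where open ≡-Reasoning

    hadamard-kernelSums : kernelSum (Features.linear n) X ≡ 0ℤ × kernelSum (Features.quadratic n) X ≡ 0ℤ ×
                          kernelSum (Features.cubic n) X ≡ 0ℤ
    hadamard-kernelSums with three-point-moments (+ l) (+ W) (+ n) (pos-2n∸2 1≤n)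
    ... | first , second , third =
      vanishing (Features.linear n) (λ z → z) (Features.kernel-linear n) first ,
      vanishing (Features.quadratic n) (λ z → z ℤ.* z ℤ.- + n) (Features.kernel-quadratic n) second ,
      vanishing (Features.cubic n) (λ z → z ℤ.* z ℤ.* z) (Features.kernel-cubic n) third
      where
      vanishing : ∀ Φ (φ : ℤ → ℤ) → (∀ x y → kernel Φ x y ≡ φ (correlation n (hamming x y))) →
                  threePointMoment (+ l) (+ W ℤ.* + l) (+ n) φ ≡ 0ℤ → kernelSum Φ X ≡ 0ℤ
      vanishing Φ φ kernel≡ moment≡0 =
        trans (kernelSum≡distanceSum Φ (λ d → φ (correlation n d)) kernel≡ X) (trans (hadamard-moment φ) moment≡0)

  even-or-odd : ∀ n → ∃ (λ m → 2 * m ≡ n) ⊎ ∃ (λ m → suc (2 * m) ≡ n)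
  even-or-odd zero    = inj₁ (0 , refl)
  even-or-odd (suc n) with even-or-odd n
  ... | inj₁ (m , 2m≡n)   = inj₂ (m , cong suc 2m≡n)
  ... | inj₂ (m , 2m+1≡n) = inj₁ (suc m , trans (ℕ.*-suc 2 m) (cong suc 2m+1≡n))

  module HadamardUnion {n f′ : ℕ} (C : List (Word n)) (uniqueC : Unique C) (lengthC : length C ≡ 2 * suc f′ * n)
           (Cs : Fin (suc f′) → List (Word n)) (uniqueCs : ∀ k → Unique (Cs k))
           (covers : ∀ x → (x ∈ C) ⇔ ∃ (λ k → x ∈ Cs k)) (profiles : ∀ k → HadamardDistribution (Cs k)) where

    private
      f : ℕ
      f = suc f′
      parts : List (Word n)
      parts = concatMap Cs (allFin f)

    C⊆parts : ∀ x → x ∈ C → x ∈ parts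
    C⊆parts x x∈ with Equivalence.to (covers x) x∈
    ... | k , x∈k = ∈-concat⁺′ x∈k (∈-map⁺ Cs (∈-allFin k))

    length-parts : ∀ l → (∀ k → length (Cs k) ≡ l) → length parts ≡ f * l
    length-parts l lengths≡ = trans (length-concatMap Cs l lengths≡ (allFin f)) (cong (_* l) (List.length-tabulate {n = f} (λ i → i)))

    odd-union-impossible : ∀ m → 0 < m → suc (2 * m) ≡ n → ⊥
    odd-union-impossible m 0<m 2m+1≡n = ℕ.<-irrefl refl (begin-strict
      2 * f * n      ≡⟨ sym lengthC ⟩
      length C       ≤⟨ unique-⊆⇒length≤ C parts uniqueC C⊆parts ⟩
      length parts   ≡⟨ length-parts 2 (λ k → hadamard-odd-length (Cs k) (uniqueCs k) 1≤n odd (profiles k)) ⟩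
      f * 2          <⟨ ℕ.m<m*n (f * 2) n 1<n ⟩
      f * 2 * n      ≡⟨ cong (_* n) (ℕ.*-comm f 2) ⟩
      2 * f * n      ∎)
      where
      open ℕ.≤-Reasoning
      1<n : 1 < n
      1<n = subst (1 <_) 2m+1≡n (s≤s (ℕ.≤-trans 0<m (ℕ.m≤m+n m _)))
      1≤n : 1 ≤ n
      1≤n = ℕ.<⇒≤ 1<n
      odd : ∀ j → 2 * j ≢ n
      odd j 2j≡n = ℕ.even≢odd j m (trans 2j≡n (sym 2m+1≡n))

    module EvenLength {m t a : ℕ} (2m≡n : 2 * m ≡ n) (m≡t+α : m ≡ t + suc a) (0<t : 0 < t)
             (distance-set : ∀ i → i ≤ n → A C i ≢ 0ℚ →
               i ≡ 0 ⊎ 2 * i + 2 * suc a ≡ n ⊎ 2 * i ≡ n ⊎ 2 * i ≡ n + 2 * suc a ⊎ i ≡ n) where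

      private
        α D c P M Q N W : ℕ
        α = suc a
        D = 2 * α
        c = length C
        P = pairCount C t
        M = pairCount C m
        Q = pairCount C (m + α)
        N = pairCount C n
        W = 2 * n ∸ 2
        ν δ : ℤ
        ν = + n
        δ = + D
        S : List ℕ
        S = 0 ∷ t ∷ m ∷ m + α ∷ n ∷ []

        2t+2α≡n : 2 * t + 2 * α ≡ n
        2t+2α≡n = trans (sym (ℕ.*-distribˡ-+ 2 t α)) (trans (cong (_*_ 2) (sym m≡t+α)) 2m≡n)
        2[m+α]≡n+2α : 2 * (m + α) ≡ n + 2 * α
        2[m+α]≡n+2α = trans (ℕ.*-distribˡ-+ 2 m α) (cong (_+ 2 * α) 2m≡n)
        α<m : α < m
        α<m = subst (α <_) (sym m≡t+α) (ℕ.m<n+m α 0<t)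
        0<m : 0 < m
        0<m = ℕ.<-trans (s≤s z≤n) α<m
        1≤n : 1 ≤ n
        1≤n = subst (1 ≤_) 2m≡n (ℕ.≤-trans 0<m (ℕ.m≤m+n m _))
        2α<n : D < n
        2α<n = subst (D <_) 2m≡n (ℕ.*-monoʳ-< 2 α<m)
        nonempty : 1 ≤ c
        nonempty = subst (1 ≤_) (sym lengthC) (ℕ.*-mono-≤ {1} {2 * f} (s≤s z≤n) 1≤n)

      side-distance : ∀ j → 2 * j + 2 * α ≡ n → j ≡ t
      side-distance j e = ℕ.*-cancelˡ-≡ j t 2 (ℕ.+-cancelʳ-≡ (2 * α) _ (2 * t) (trans e (sym 2t+2α≡n)))

      middle-distance : ∀ j → 2 * j ≡ n → j ≡ m
      middle-distance j e = ℕ.*-cancelˡ-≡ j m 2 (trans e (sym 2m≡n))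

      far-distance : ∀ j → 2 * j ≡ n + 2 * α → j ≡ m + α
      far-distance j e = ℕ.*-cancelˡ-≡ j (m + α) 2 (trans e (sym 2[m+α]≡n+2α))

      code-distances : ∀ x y → x ∈ C → y ∈ C → hamming x y ∈ S
      code-distances x y x∈ y∈ with distance-set (hamming x y) (hamming≤n x y) (A≢0-at-occurring-distance C x∈ y∈)
      ... | inj₁ d≡0                             = here d≡0
      ... | inj₂ (inj₁ side)                     = there (here (side-distance _ side))
      ... | inj₂ (inj₂ (inj₁ middle))            = there (there (here (middle-distance _ middle)))
      ... | inj₂ (inj₂ (inj₂ (inj₁ far)))        = there (there (there (here (far-distance _ far))))
      ... | inj₂ (inj₂ (inj₂ (inj₂ d≡n)))        = there (there (there (there (here d≡n))))

      code-moment : ∀ φ → distanceSum C (λ d → φ (correlation n d)) ≡ fivePointMoment (+ c) (+ P) (+ M) (+ Q) (+ N) ν δ φ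
      code-moment φ = trans (distanceSum-decomposition C S distinct code-distances _)
        (cong₂ ℤ._+_ (cong₂ ℤ._*_ (cong +_ (pairCount-0 C uniqueC)) (cong φ (correlation-below 0 n refl)))
        (cong₂ ℤ._+_ (cong (λ z → + P ℤ.* φ z) (correlation-below t D 2t+2α≡n))
        (cong₂ ℤ._+_ (cong (λ z → + M ℤ.* φ z) (correlation-below m 0 (trans (ℕ.+-identityʳ _) 2m≡n)))
        (cong₂ ℤ._+_ (cong (λ z → + Q ℤ.* φ z) (correlation-above (m + α) D 2[m+α]≡n+2α))
                     (cong (λ z → + N ℤ.* φ z ℤ.+ 0ℤ) (correlation-above n n (cong (_+_ n) (ℕ.+-identityʳ n))))))))
        where
        distinct : AllPairs _≢_ S
        distinct = ascending⇒distinct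
          (0<t ∷ subst (t <_) (sym m≡t+α) (ℕ.m<m+n t (s≤s z≤n)) ∷ ℕ.m<m+n m (s≤s z≤n) ∷ m+α<n ∷ [-])
          where
          m+α<n : m + α < n
          m+α<n = subst (m + α <_) (trans (cong (_+_ m) (sym (ℕ.+-identityʳ m))) 2m≡n) (ℕ.+-monoʳ-< m α<m)

      code-kernelSums : kernelSum (Features.linear n) C ≡ 0ℤ × kernelSum (Features.quadratic n) C ≡ 0ℤ ×
                        kernelSum (Features.cubic n) C ≡ 0ℤ
      code-kernelSums =
        kernelSum-union (Features.linear n) C Cs C↭parts (λ k → proj₁ (part k)) ,
        kernelSum-union (Features.quadratic n) C Cs C↭parts (λ k → proj₁ (proj₂ (part k))) ,
        kernelSum-union (Features.cubic n) C Cs C↭parts (λ k → proj₂ (proj₂ (part k)))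
        where
        part : ∀ k → kernelSum (Features.linear n) (Cs k) ≡ 0ℤ × kernelSum (Features.quadratic n) (Cs k) ≡ 0ℤ ×
                     kernelSum (Features.cubic n) (Cs k) ≡ 0ℤ
        part k = hadamard-kernelSums (Cs k) (uniqueCs k) 0<m 2m≡n (profiles k)
        C↭parts : C ↭ parts
        C↭parts = unique-⊆⇒↭ C parts uniqueC C⊆parts (begin
          length parts     ≡⟨ length-parts (2 * n) (λ k → hadamard-length (Cs k) (uniqueCs k) 0<m 2m≡n (profiles k)) ⟩
          f * (2 * n)      ≡⟨ sym (ℕ.*-assoc f 2 n) ⟩
          f * 2 * n        ≡⟨ cong (_* n) (ℕ.*-comm f 2) ⟩
          2 * f * n        ≡⟨ sym lengthC ⟩
          length C         ∎)
          where open ≡-Reasoning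

      code-counts : + N ≡ + c × + Q ≡ + P × + M ≡ + c ℤ.* + c ℤ.- + 2 ℤ.* + c ℤ.- + 2 ℤ.* + P ×
                    + 2 ℤ.* + P ℤ.* (δ ℤ.* δ) ≡ ν ℤ.* + c ℤ.* (+ c ℤ.- + 2 ℤ.* ν)
      code-counts = five-point-distribution (+ c) (+ P) (+ M) (+ Q) (+ N) ν δ (pos≢0 1≤n) (nonzero-product {δ} (λ ()) ν²≢δ²)
        (trans (sym (code-moment (λ _ → 1ℤ))) (distanceSum-const C))
        (vanishing (Features.linear n) (λ z → z) (Features.kernel-linear n) (proj₁ code-kernelSums))
        (vanishing (Features.quadratic n) (λ z → z ℤ.* z ℤ.- ν) (Features.kernel-quadratic n) (proj₁ (proj₂ code-kernelSums)))
        (vanishing (Features.cubic n) (λ z → z ℤ.* z ℤ.* z) (Features.kernel-cubic n) (proj₂ (proj₂ code-kernelSums)))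
        where
        vanishing : ∀ Φ (φ : ℤ → ℤ) → (∀ x y → kernel Φ x y ≡ φ (correlation n (hamming x y))) →
                    kernelSum Φ C ≡ 0ℤ → fivePointMoment (+ c) (+ P) (+ M) (+ Q) (+ N) ν δ φ ≡ 0ℤ
        vanishing Φ φ kernel≡ kernelSum≡0 =
          trans (sym (code-moment φ)) (trans (sym (kernelSum≡distanceSum Φ (λ d → φ (correlation n d)) kernel≡ C)) kernelSum≡0)
        ν²≢δ² : ν ℤ.* ν ℤ.- δ ℤ.* δ ≢ 0ℤ
        ν²≢δ² ν²-δ²≡0 = ℕ.<⇒≢ (ℕ.*-mono-< 2α<n 2α<n) (ℤ.+-injective (begin
          + (D * D)       ≡⟨ ℤ.pos-* D D ⟩
          δ ℤ.* δ         ≡⟨ sym (ℤ.i-j≡0⇒i≡j _ _ ν²-δ²≡0) ⟩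
          ν ℤ.* ν         ≡⟨ sym (ℤ.pos-* n n) ⟩
          + (n * n)       ∎))
          where open ≡-Reasoning

      private
        c≡ : + c ≡ + 2 ℤ.* (1ℤ ℤ.+ + f′) ℤ.* ν
        c≡ = trans (cong +_ lengthC) (trans (ℤ.pos-* (2 * f) n) (cong (ℤ._* ν) (ℤ.pos-* 2 f)))
        P≡ : + P ℤ.* + (D * D) ≡ + f′ ℤ.* (ν ℤ.* ν) ℤ.* + c
        P≡ = union-side-count (+ P) (+ c) ν δ (+ f′) (+ (D * D)) c≡ (ℤ.pos-* D D) (proj₂ (proj₂ (proj₂ code-counts)))

      A-at-0 : A C 0 ≡ 1ℚ
      A-at-0 = pairCount≡length⇒A≡1 C 0 nonempty (pairCount-0 C uniqueC)

      A-at-side : ∀ j → 2 * j + 2 * α ≡ n → A C j ≡ ℕ→ℚ f′ *ℚ ell n α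
      A-at-side j e with side-distance j e
      ... | refl = pairCount⇒A≡ C t _ (D * D) nonempty (toℚᵘ-ℕ→ℚ*ell n a f′) P≡

      A-at-middle : ∀ j → 2 * j ≡ n → A C j ≡ ℕ→ℚ W +ℚ ℕ→ℚ f′ *ℚ (ℕ→ℚ (2 * n) -ℚ ℕ→ℚ 2 *ℚ ell n α)
      A-at-middle j e with middle-distance j e
      ... | refl = pairCount⇒A≡ C m _ (D * D) nonempty (toℚᵘ-middle-frequency n a W f′)
        (union-mid-count (+ M) (+ P) (+ c) ν δ (+ f′) (+ W) (+ (2 * n)) (+ (D * D))
          c≡ (pos-2n∸2 1≤n) (ℤ.pos-* 2 n) (ℤ.pos-* D D) (proj₁ (proj₂ (proj₂ code-counts))) P≡)

      A-at-far : ∀ j → 2 * j ≡ n + 2 * α → A C j ≡ ℕ→ℚ f′ *ℚ ell n α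
      A-at-far j e with far-distance j e
      ... | refl = pairCount⇒A≡ C (m + α) _ (D * D) nonempty (toℚᵘ-ℕ→ℚ*ell n a f′)
        (trans (cong (ℤ._* + (D * D)) (proj₁ (proj₂ code-counts))) P≡)

      A-at-n : A C n ≡ 1ℚ
      A-at-n = pairCount≡length⇒A≡1 C n nonempty (ℤ.+-injective (proj₁ code-counts))

      A-elsewhere : ∀ j → j ≢ 0 → 2 * j + 2 * α ≢ n → 2 * j ≢ n → 2 * j ≢ n + 2 * α → j ≢ n → A C j ≡ 0ℚ
      A-elsewhere j j≢0 j≢side j≢middle j≢far j≢n =
        pairCount≡0⇒A≡0 C j nonempty
          (pairCount-absent C j (λ x y x∈ y∈ d≡j → j∉S (subst (_∈ S) d≡j (code-distances x y x∈ y∈))))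
        where
        j∉S : j ∈ S → ⊥
        j∉S (here j≡0)                                = j≢0 j≡0
        j∉S (there (here refl))                       = j≢side 2t+2α≡n
        j∉S (there (there (here refl)))               = j≢middle 2m≡n
        j∉S (there (there (there (here refl))))       = j≢far 2[m+α]≡n+2α
        j∉S (there (there (there (there (here j≡n))))) = j≢n j≡n

open import Defs
open import Data.Nat using (ℕ; _+_; _*_; _∸_; _≤_; _<_)
open import Data.Fin using (Fin)
open import Data.Product using (_×_; ∃)
open import Data.Sum using (_⊎_)
open import Data.List using (List; length)
open import Data.List.Membership.Propositional using (_∈_)
open import Data.List.Relation.Unary.Unique.Propositional using (Unique)
open import Data.Rational using (ℚ; 0ℚ; 1ℚ) renaming (_+_ to _+ℚ_; _*_ to _*ℚ_; _-_ to _-ℚ_)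
open import Relation.Binary.PropositionalEquality using (_≡_; _≢_)
open import Function.Bundles using (_⇔_)

open HadamardCodes
open import Data.Nat using (suc; s≤s; z≤n)
import Data.Nat.Properties as ℕ
open import Data.Product using (_,_)
open import Data.Sum using (inj₁; inj₂)
open import Data.Empty using (⊥-elim)
open import Relation.Binary.PropositionalEquality using (sym; subst)
open import Function.Bundles using (Equivalence)

proposition5p6 :
    (n f α : ℕ) → 1 ≤ n → 1 ≤ f → 0 < α → 2 * α < n →
    (C : List (Word n)) → Unique C → length C ≡ 2 * f * n →
    (∀ i → i ≤ n → ((A C i ≢ 0ℚ) ⇔ (i ≡ 0 ⊎ 2 * i + 2 * α ≡ n ⊎ 2 * i ≡ n ⊎ 2 * i ≡ n + 2 * α ⊎ i ≡ n))) →
    (Cs : Fin f → List (Word n)) →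
    (∀ k → Unique (Cs k)) →
    (∀ x → (x ∈ C) ⇔ ∃ (λ k → x ∈ Cs k)) →
    (∀ k → A (Cs k) 0 ≡ 1ℚ
         × (∀ j → 2 * j ≡ n → A (Cs k) j ≡ ℕ→ℚ (2 * n ∸ 2))
         × A (Cs k) n ≡ 1ℚ
         × (∀ j → j ≢ 0 → 2 * j ≢ n → j ≢ n → A (Cs k) j ≡ 0ℚ)) →
    A C 0 ≡ 1ℚ
    × (∀ j → 2 * j + 2 * α ≡ n → A C j ≡ ℕ→ℚ (f ∸ 1) *ℚ ell n α)
    × (∀ j → 2 * j ≡ n → A C j ≡ ℕ→ℚ (2 * n ∸ 2) +ℚ ℕ→ℚ (f ∸ 1) *ℚ (ℕ→ℚ (2 * n) -ℚ ℕ→ℚ 2 *ℚ ell n α))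
    × (∀ j → 2 * j ≡ n + 2 * α → A C j ≡ ℕ→ℚ (f ∸ 1) *ℚ ell n α)
    × A C n ≡ 1ℚ
    × (∀ j → j ≢ 0 → 2 * j + 2 * α ≢ n → 2 * j ≢ n → 2 * j ≢ n + 2 * α → j ≢ n → A C j ≡ 0ℚ)
proposition5p6 n (suc f′) (suc a) _ _ (s≤s z≤n) 2α<n C uniqueC lengthC distances Cs uniqueCs covers profiles
  with even-or-odd n
... | inj₂ (m , 2m+1≡n) = ⊥-elim (odd-union-impossible m (ℕ.<-≤-trans (s≤s z≤n) α≤m) 2m+1≡n)
  where
  open HadamardUnion C uniqueC lengthC Cs uniqueCs covers profiles
  α≤m : suc a ≤ m
  α≤m = ℕ.*-cancelˡ-≤ 2 (ℕ.≤-pred (subst (2 * suc a <_) (sym 2m+1≡n) 2α<n))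
... | inj₁ (m , 2m≡n) = A-at-0 , A-at-side , A-at-middle , A-at-far , A-at-n , A-elsewhere
  where
  open HadamardUnion C uniqueC lengthC Cs uniqueCs covers profiles
  α<m : suc a < m
  α<m = ℕ.*-cancelˡ-< 2 _ _ (subst (2 * suc a <_) (sym 2m≡n) 2α<n)
  open EvenLength 2m≡n (sym (ℕ.m∸n+n≡m (ℕ.<⇒≤ α<m))) (ℕ.m<n⇒0<n∸m α<m) (λ i i≤n → Equivalence.to (distances i i≤n))
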